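{- Let $\varphi$ be a $\mathrm{GP}^2$ sentence in normal form such that $\mathbf{0}\notin\mathcal{B}^\varphi_\pi$ for every $\pi\in\mathsf{OneTps}^\varphi$. Then $\varphi$ is finitely satisfiable if and only if there exist vectors $\mathbf{g}_\pi\in(\mathcal{B}^\varphi_\pi)^{*}$, one for each $\pi\in\mathsf{OneTps}^\varphi$, such that: (Matching) for every $\langle\pi_1,\eta,\pi_2\rangle\in\mathsf{OneTps}^\varphi\times\mathsf{TwoTps}^+\times\mathsf{OneTps}^\varphi$, $\mathbf{g}_{\pi_1}(\eta,\pi_2)=\mathbf{g}_{\pi_2}(\bar\eta,\pi_1)$; and (Non-triviality) $\mathbf{g}_\pi\neq\mathbf{0}$ for some $\pi\in\mathsf{OneTps}^\varphi$.
   Context: Vocabulary: unary $U_1,\dots,U_n$, binary $R_1,\dots,R_m$. 1-types: maximal consistent subsets of $\{U_i(x),\neg U_i(x)\}_{i\le n}\cup\{R_i(x,x),\neg R_i(x,x)\}_{i\le m}$ ($\mathsf{OneTps}$). 2-types: maximal consistent subsets of $\{R_i(x,y),\neg R_i(x,y),R_i(y,x),\neg R_i(y,x)\}_{i\le m}$; the silent 2-type has only negated literals, the rest are audible ($\mathsf{TwoTps}^+$); $\bar\eta$ (dual) swaps $x,y$; $\mathsf{TwoTps}_t$ = 2-types containing $R_t(x,y)$. Normal form $\mathrm{GP}^2$ sentence: $\varphi=\forall x\,\gamma(x)\wedge\bigwedge_{i\le m}\forall x\forall y\,(R_i(x,y)\wedge x\neq y)\to\alpha_i(x,y)\wedge\bigwedge_{i\le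 n}\forall x\,U_i(x)\to P_i(x)$ with $\gamma,\alpha_i$ quantifier-free and $P_i(x)=\big(\sum_{t\le m}\lambda_{i,t}\#_y[R_t(x,y)\wedge x\neq y]\big)\circledast_i\delta_i$ (integers, (in)equality $\circledast_i$; $\#_y$ counts witnesses $y$). $\mathsf{OneTps}^\varphi$ is the set of 1-types $\pi$ with $\pi(x)\models\gamma(x)$. $\langle\pi_1,\eta,\pi_2\rangle$ is compatible with $\varphi$ if $\pi_1(x)\wedge\eta(x,y)\wedge\pi_2(y)$ and $\pi_2(x)\wedge\bar\eta(x,y)\wedge\pi_1(y)$ both entail $\bigwedge_i(R_i(x,y)\wedge x\neq y)\to\alpha_i(x,y)$. Behavior vectors are elements of $\mathbb{N}^{\mathsf{TwoTps}^+\times\mathsf{OneTps}}$, with $\mathbf{f}(\eta,\pi)$ the entry at $(\eta,\pi)$. For a 1-type $\pi$, $\mathcal{B}^\varphi_\pi\subseteq\mathbb{N}^{\mathsf{TwoTps}^+\times\mathsf{OneTps}}$ is the set of natural-number solutions of the system with variables $x_{\eta,\pi'}$: $x_{\eta,\pi'}=0$ whenever $\pi'\notin\mathsf{OneTps}^\varphi$ or $\langle\pi,\eta,\pi'\rangle$ is incompatible with $\varphi$; and for each $i$ with $U_i(x)\in\pi$, $\big(\sum_t\lambda_{i,t}\sum_{\eta\in\mathsf{TwoTps}_t}\sum_{\pi'}x_{\eta,\pi'}\big)\circledast_i\delta_i$. For $\mathcal{S}\subseteq\mathbb{N}^d$, $\mathcal{S}^*$ is the set of all sums of finite multisubsets of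 $\mathcal{S}$. Finitely satisfiable means having a finite model. -}

module Defs where

open import Data.Nat using (ℕ; zero; suc)
open import Data.Bool using (Bool; true; false; T; _∧_; _∨_; not; if_then_else_)
open import Data.Bool.Properties using (∨-comm)
open import Data.Fin using (Fin; zero; suc; _≟_)
open import Data.Vec using (Vec; []; _∷_; lookup)
open import Data.List using (List; []; _∷_; map; concatMap; foldr)
open import Data.List.Relation.Unary.All using (All)
open import Data.Integer as ℤ using (ℤ; +_; 0ℤ)
open import Data.Product using (Σ; _×_; _,_; proj₁; proj₂)
open import Relation.Nullary using (¬_; Dec; yes; no)
open import Relation.Nullary.Decidable using (⌊_⌋; T?)
open import Relation.Binary.PropositionalEquality using (_≡_; _≢_; subst)

allFin : (k : ℕ) → List (Fin k)
allFin zero    = []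
allFin (suc k) = zero ∷ map suc (allFin k)

allBoolVecs : (k : ℕ) → List (Vec Bool k)
allBoolVecs zero    = [] ∷ []
allBoolVecs (suc k) =
  concatMap (λ b → map (b ∷_) (allBoolVecs k)) (true ∷ false ∷ [])

sumℕ : List ℕ → ℕ
sumℕ = foldr Data.Nat._+_ 0

sumℤ : List ℤ → ℤ
sumℤ = foldr ℤ._+_ 0ℤ

anyTrue : {k : ℕ} → Vec Bool k → Bool
anyTrue []       = false
anyTrue (b ∷ bs) = b ∨ anyTrue bs

record Structure (n m k : ℕ) : Set where
  field
    U : Fin n → Fin k → Bool
    R : Fin m → Fin k → Fin k → Bool

open Structure public

data QF (n m V : ℕ) : Set where
  tt   : QF n m V
  atU  : Fin n → Fin V → QF n m V
  atR  : Fin m → Fin V → Fin V → QF n m V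
  atEq : Fin V → Fin V → QF n m V
  neg  : QF n m V → QF n m V
  and  : QF n m V → QF n m V → QF n m V
  or   : QF n m V → QF n m V → QF n m V

eval : {n m k V : ℕ} → Structure n m k → (Fin V → Fin k) → QF n m V → Bool
eval A ρ tt          = true
eval A ρ (atU i v)   = U A i (ρ v)
eval A ρ (atR i v w) = R A i (ρ v) (ρ w)
eval A ρ (atEq v w)  = ⌊ ρ v ≟ ρ w ⌋
eval A ρ (neg φ)     = not (eval A ρ φ)
eval A ρ (and φ ψ)   = eval A ρ φ ∧ eval A ρ ψ
eval A ρ (or φ ψ)    = eval A ρ φ ∨ eval A ρ ψ

-- assignment x ↦ a, y ↦ b (x = variable 0, y = variable 1)
env₂ : {k : ℕ} → Fin k → Fin k → Fin 2 → Fin k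
env₂ a b zero       = a
env₂ a b (suc zero) = b

data Cmp : Set where
  ceq cneq clt cle cgt cge : Cmp

holdsCmp : Cmp → ℤ → ℤ → Set
holdsCmp ceq  a b = a ≡ b
holdsCmp cneq a b = a ≢ b
holdsCmp clt  a b = a ℤ.< b
holdsCmp cle  a b = a ℤ.≤ b
holdsCmp cgt  a b = a ℤ.> b
holdsCmp cge  a b = a ℤ.≥ b

-- GP² sentences in normal form
--   ∀x γ(x) ∧ ⋀ᵢ ∀x∀y (Rᵢ(x,y) ∧ x≠y → αᵢ(x,y))
--           ∧ ⋀ᵢ ∀x (Uᵢ(x) → (Σₜ λᵢₜ #_y[Rₜ(x,y) ∧ x≠y]) ⊛ᵢ δᵢ)

record GP2 (n m : ℕ) : Set where
  field
    γ   : QF n m 1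
    α   : Fin m → QF n m 2
    lam : Fin n → Fin m → ℤ
    cmp : Fin n → Cmp
    δ   : Fin n → ℤ

open GP2 public

countR : {n m k : ℕ} → Structure n m k → Fin m → Fin k → ℕ
countR {k = k} A t a =
  sumℕ (map (λ b → if R A t a b ∧ not ⌊ a ≟ b ⌋ then 1 else 0) (allFin k))

_⊨_ : {n m k : ℕ} → Structure n m k → GP2 n m → Set
_⊨_ {n} {m} {k} A φ =
  ((a : Fin k) → eval A (λ _ → a) (γ φ) ≡ true)
  × ((i : Fin m) (a b : Fin k) → R A i a b ≡ true → a ≢ b →
       eval A (env₂ a b) (α φ i) ≡ true)
  × ((i : Fin n) (a : Fin k) → U A i a ≡ true →
       holdsCmp (cmp φ i)
         (sumℤ (map (λ t → lam φ i t ℤ.* (+ countR A t a)) (allFin m)))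
         (δ φ i))

-- finite model (with non-empty domain, as usual in first-order logic)
FinitelySatisfiable : {n m : ℕ} → GP2 n m → Set
FinitelySatisfiable {n} {m} φ =
  Σ ℕ λ k → Σ (Structure n m (suc k)) λ A → A ⊨ φ

-- 1-types and 2-types
-- A 1-type is given by which Uᵢ(x) and which Rᵢ(x,x) are positive.
-- A 2-type is given by which Rᵢ(x,y) and which Rᵢ(y,x) are positive.

OneTp : ℕ → ℕ → Set
OneTp n m = Vec Bool n × Vec Bool m

TwoTp : ℕ → Set
TwoTp m = Vec Bool m × Vec Bool m

allOneTps : (n m : ℕ) → List (OneTp n m)
allOneTps n m = concatMap (λ u → map (u ,_) (allBoolVecs m)) (allBoolVecs n)

allTwoTps : (m : ℕ) → List (TwoTp m)
allTwoTps m = concatMap (λ f → map (f ,_) (allBoolVecs m)) (allBoolVecs m)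

audible : {m : ℕ} → TwoTp m → Bool
audible (f , b) = anyTrue f ∨ anyTrue b

TwoTp⁺ : ℕ → Set
TwoTp⁺ m = Σ (TwoTp m) (λ η → T (audible η))

dual : {m : ℕ} → TwoTp m → TwoTp m
dual (f , b) = (b , f)

dual⁺ : {m : ℕ} → TwoTp⁺ m → TwoTp⁺ m
dual⁺ ((f , b) , p) = (b , f) , subst T (∨-comm (anyTrue f) (anyTrue b)) p

Realizes₁ : {n m k : ℕ} → Structure n m k → Fin k → OneTp n m → Set
Realizes₁ {n} {m} A a (u , r) =
  ((i : Fin n) → U A i a ≡ lookup u i) × ((i : Fin m) → R A i a a ≡ lookup r i)

Realizes₂ : {n m k : ℕ} → Structure n m k → Fin k → Fin k → TwoTp m → Set
Realizes₂ {n} {m} A a b (f , g) =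
  ((i : Fin m) → R A i a b ≡ lookup f i) × ((i : Fin m) → R A i b a ≡ lookup g i)

InOneTps : {n m : ℕ} → GP2 n m → OneTp n m → Set
InOneTps {n} {m} φ π =
  (k : ℕ) (A : Structure n m k) (a : Fin k) →
  Realizes₁ A a π → eval A (λ _ → a) (γ φ) ≡ true

Entails : {n m : ℕ} → GP2 n m → OneTp n m → TwoTp m → OneTp n m → Set
Entails {n} {m} φ π₁ η π₂ =
  (k : ℕ) (A : Structure n m k) (a b : Fin k) →
  Realizes₁ A a π₁ → Realizes₂ A a b η → Realizes₁ A b π₂ →
  (i : Fin m) → R A i a b ≡ true → a ≢ b → eval A (env₂ a b) (α φ i) ≡ true

Compatible : {n m : ℕ} → GP2 n m → OneTp n m → TwoTp m → OneTp n m → Set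
Compatible φ π₁ η π₂ = Entails φ π₁ η π₂ × Entails φ π₂ (dual η) π₁

BVec : ℕ → ℕ → Set
BVec n m = TwoTp⁺ m → OneTp n m → ℕ

zeroB : {n m : ℕ} → BVec n m
zeroB _ _ = 0

_+B_ : {n m : ℕ} → BVec n m → BVec n m → BVec n m
(f +B g) η π = f η π Data.Nat.+ g η π

sumB : {n m : ℕ} → List (BVec n m) → BVec n m
sumB = foldr _+B_ zeroB

_≈B_ : {n m : ℕ} → BVec n m → BVec n m → Set
f ≈B g = ∀ η π → f η π ≡ g η π

ext : {n m : ℕ} → BVec n m → TwoTp m → OneTp n m → ℕ
ext f η π with T? (audible η)
... | yes p = f (η , p) π
... | no _  = 0

linSum : {n m : ℕ} → GP2 n m → Fin n → BVec n m → ℤ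
linSum {n} {m} φ i f =
  sumℤ (map (λ t → lam φ i t ℤ.*
    (+ sumℕ (map (λ η → if lookup (proj₁ η) t
                          then sumℕ (map (ext f η) (allOneTps n m))
                          else 0)
                 (allTwoTps m))))
    (allFin m))

InB : {n m : ℕ} → GP2 n m → OneTp n m → BVec n m → Set
InB {n} {m} φ π f =
  ((η : TwoTp⁺ m) (π' : OneTp n m) → ¬ InOneTps φ π' → f η π' ≡ 0)
  × ((η : TwoTp⁺ m) (π' : OneTp n m) → ¬ Compatible φ π (proj₁ η) π' → f η π' ≡ 0)
  × ((i : Fin n) → lookup (proj₁ π) i ≡ true →
       holdsCmp (cmp φ i) (linSum φ i f) (δ φ i))

Star : {n m : ℕ} → (BVec n m → Set) → BVec n m → Set
Star {n} {m} S g = Σ (List (BVec n m)) λ l → All S l × (g ≈B sumB l)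

{-# OPTIONS --safe #-}
-- (⇒) In a finite model, the vector counting the neighbours of an element by 2-type and 1-type lies
-- in 𝓑_π for π the 1-type of the element. Summing these vectors over the elements of each 1-type gives
-- the g_π; they match because both sides count the same ordered pairs, and they are not all 0 because
-- 0 ∉ 𝓑_π.
-- (⇐) Each summand f ∈ 𝓑_π of a decomposition of g_π becomes an element of type π demanding f(η, π′)
-- neighbours of each kind. By matching, the demands of the type-π elements for (η, π′) and those of
-- the type-π′ elements for (η̄, π) add up to the same number of slots; cutting the slots into
-- consecutive blocks according to each side's demands gives every slot one owner on each side. Take
-- every element in two sides and with every label of a vector space over ℤ/2, and join two copies
-- through a slot owned by both when their labels differ by a code of the slot: then every copy gets
-- exactly its demanded neighbours and no pair is joined twice, and membership in 𝓑 yields the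
-- compatibility and counting constraints.
module Submission where

open import Defs
open import Data.Nat using (ℕ; zero; suc; _+_; _*_; _∸_; _<_; _≤_; z≤n; s≤s; _<?_; _≟_)
open import Data.Nat.Properties
open import Algebra.Properties.CommutativeSemigroup +-commutativeSemigroup using (interchange)
open import Data.Nat.ListAction.Properties using (sum-++)
open import Data.Bool using (Bool; true; false; if_then_else_; T; _∧_; _∨_; not; _xor_)
open import Data.Fin using (Fin; zero; suc; toℕ)
import Data.Fin.Properties as Fin
open import Data.Vec using (Vec; []; _∷_; lookup; tabulate)
import Data.Vec.Properties as Vec
open import Data.List using (List; []; _∷_; map; concatMap; _++_; length; filter)
open import Data.List.Relation.Unary.All using (All; []; _∷_)
import Data.List.Relation.Unary.All as All
import Data.List.Relation.Unary.All.Properties as All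
import Data.List.Properties as List
open import Data.Product using (Σ; _×_; _,_; proj₁; proj₂)
import Data.Product.Properties as Product
import Data.Bool.Properties as Bool
import Data.Integer as ℤ
open import Data.Empty using (⊥-elim)
open import Relation.Nullary using (¬_; Dec; yes; no)
open import Relation.Nullary.Decidable using (⌊_⌋; ¬?; T?; map′; toWitness; decidable-stable; _×-dec_; _→-dec_)
open import Relation.Binary.Definitions using (DecidableEquality)
open import Relation.Binary.PropositionalEquality
open import Function using (_∘_)
open import Function.Bundles using (_⇔_; mk⇔)

private variable
  X Y Z : Set

∑ : List X → (X → ℕ) → ℕ
∑ xs F = sumℕ (map F xs)

∑-cong : (xs : List X) {F G : X → ℕ} → (∀ x → F x ≡ G x) → ∑ xs F ≡ ∑ xs G
∑-cong xs F≗G = cong sumℕ (List.map-cong F≗G xs)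

∑-zero : (xs : List X) {F : X → ℕ} → (∀ x → F x ≡ 0) → ∑ xs F ≡ 0
∑-zero []       F≗0 = refl
∑-zero (x ∷ xs) F≗0 = cong₂ _+_ (F≗0 x) (∑-zero xs F≗0)

∑-distrib-+ : (xs : List X) (F G : X → ℕ) → ∑ xs (λ x → F x + G x) ≡ ∑ xs F + ∑ xs G
∑-distrib-+ []       F G = refl
∑-distrib-+ (x ∷ xs) F G =
  trans (cong (F x + G x +_) (∑-distrib-+ xs F G)) (interchange (F x) (G x) (∑ xs F) (∑ xs G))

∑-comm : (xs : List X) (ys : List Y) (F : X → Y → ℕ) →
  ∑ xs (λ x → ∑ ys (F x)) ≡ ∑ ys (λ y → ∑ xs (λ x → F x y))
∑-comm []       ys F = sym (∑-zero ys (λ _ → refl))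
∑-comm (x ∷ xs) ys F =
  trans (cong (∑ ys (F x) +_) (∑-comm xs ys F)) (sym (∑-distrib-+ ys (F x) _))

∑-map : (xs : List X) (g : X → Y) (F : Y → ℕ) → ∑ (map g xs) F ≡ ∑ xs (λ x → F (g x))
∑-map xs g F = cong sumℕ (sym (List.map-∘ xs))

∑-concatMap : (xs : List X) (h : X → List Y) (F : Y → ℕ) →
  ∑ (concatMap h xs) F ≡ ∑ xs (λ x → ∑ (h x) F)
∑-concatMap []       h F = refl
∑-concatMap (x ∷ xs) h F = begin
  sumℕ (map F (h x ++ concatMap h xs))          ≡⟨ cong sumℕ (List.map-++ F (h x) (concatMap h xs)) ⟩
  sumℕ (map F (h x) ++ map F (concatMap h xs))  ≡⟨ sum-++ (map F (h x)) _ ⟩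
  ∑ (h x) F + ∑ (concatMap h xs) F              ≡⟨ cong (∑ (h x) F +_) (∑-concatMap xs h F) ⟩
  ∑ (h x) F + ∑ xs (λ x → ∑ (h x) F)            ∎
  where open ≡-Reasoning

∑-*ˡ : (xs : List X) (c : ℕ) (F : X → ℕ) → ∑ xs (λ x → c * F x) ≡ c * ∑ xs F
∑-*ˡ []       c F = sym (*-zeroʳ c)
∑-*ˡ (x ∷ xs) c F = trans (cong (c * F x +_) (∑-*ˡ xs c F)) (sym (*-distribˡ-+ c (F x) _))

∑-allFin-lookup : (xs : List X) (F : X → ℕ) → ∑ (allFin (length xs)) (F ∘ Data.List.lookup xs) ≡ ∑ xs F
∑-allFin-lookup []       F = refl
∑-allFin-lookup (x ∷ xs) F =
  cong (F x +_) (trans (∑-map (allFin (length xs)) suc _) (∑-allFin-lookup xs F))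

∑-if : (xs : List X) (b : Bool) (F : X → ℕ) →
  ∑ xs (λ x → if b then F x else 0) ≡ (if b then ∑ xs F else 0)
∑-if xs true  F = refl
∑-if xs false F = ∑-zero xs (λ _ → refl)

∑-mono-≤ : (xs : List X) {F G : X → ℕ} → (∀ x → F x ≤ G x) → ∑ xs F ≤ ∑ xs G
∑-mono-≤ []       F≤G = z≤n
∑-mono-≤ (x ∷ xs) F≤G = +-mono-≤ (F≤G x) (∑-mono-≤ xs F≤G)

⌊⌋-yes : {P : Set} (d : Dec P) → P → ⌊ d ⌋ ≡ true
⌊⌋-yes (yes _) _ = refl
⌊⌋-yes (no ¬p) p = ⊥-elim (¬p p)

⌊⌋-no : {P : Set} (d : Dec P) → ¬ P → ⌊ d ⌋ ≡ false
⌊⌋-no (yes p) ¬p = ⊥-elim (¬p p)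
⌊⌋-no (no _)  _  = refl

if-true : {c : Bool} {x y : X} → c ≡ true → (if c then x else y) ≡ x
if-true refl = refl

if-false : {c : Bool} {x y : X} → c ≡ false → (if c then x else y) ≡ y
if-false refl = refl

𝟙 : {P : Set} → Dec P → ℕ
𝟙 (yes _) = 1
𝟙 (no _)  = 0

𝟙-yes : {P : Set} (d : Dec P) → P → 𝟙 d ≡ 1
𝟙-yes (yes _) _ = refl
𝟙-yes (no ¬p) p = ⊥-elim (¬p p)

𝟙-no : {P : Set} (d : Dec P) → ¬ P → 𝟙 d ≡ 0
𝟙-no (yes p) ¬p = ⊥-elim (¬p p)
𝟙-no (no _)  _  = refl

𝟙-cong : {P Q : Set} (d : Dec P) (e : Dec Q) → (P → Q) → (Q → P) → 𝟙 d ≡ 𝟙 e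
𝟙-cong (yes p) e P→Q Q→P = sym (𝟙-yes e (P→Q p))
𝟙-cong (no ¬p) e P→Q Q→P = sym (𝟙-no e (¬p ∘ Q→P))

𝟙-*-yes : {P : Set} (d : Dec P) → P → (x : ℕ) → 𝟙 d * x ≡ x
𝟙-*-yes d p x = trans (cong (_* x) (𝟙-yes d p)) (*-identityˡ x)

𝟙-×-dec : {P Q : Set} (d : Dec P) (e : Dec Q) → 𝟙 (d ×-dec e) ≡ 𝟙 d * 𝟙 e
𝟙-×-dec (yes _) (yes _) = refl
𝟙-×-dec (yes _) (no _)  = refl
𝟙-×-dec (no _)  _       = refl

𝟙-*-≤ : {P : Set} (d : Dec P) (x : ℕ) → 𝟙 d * x ≤ x
𝟙-*-≤ (yes _) x = ≤-reflexive (*-identityˡ x)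
𝟙-*-≤ (no _)  x = z≤n

𝟙-*-positive : {P : Set} (d : Dec P) (x : ℕ) → 0 < 𝟙 d * x → P × 0 < x
𝟙-*-positive (yes p) x pos = p , subst (0 <_) (*-identityˡ x) pos

∑-filter : {P : X → Set} (P? : ∀ x → Dec (P x)) (xs : List X) (F : X → ℕ) →
  ∑ (filter P? xs) F ≡ ∑ xs (λ x → 𝟙 (P? x) * F x)
∑-filter P? []       F = refl
∑-filter P? (x ∷ xs) F with P? x
... | yes _ = cong₂ _+_ (sym (+-identityʳ (F x))) (∑-filter P? xs F)
... | no  _ = ∑-filter P? xs F

-- Each element occurs exactly once in xs, in the only form in which this is used.
record Enumerates (xs : List X) : Set where
  constructor enumerates
  field
    ∑-pick : (F : X → ℕ) (x : X) → (∀ y → y ≢ x → F y ≡ 0) → ∑ xs F ≡ F x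

open Enumerates

module _ (_⊗_ : X → Y → Z) (⊗-injective : ∀ {x x′ y y′} → x ⊗ y ≡ x′ ⊗ y′ → x ≡ x′ × y ≡ y′)
         {xs : List X} {ys : List Y} (xs-enum : Enumerates xs) (ys-enum : Enumerates ys) where

  ∑-concatMap-⊗ : (F : Z → ℕ) (x : X) (y : Y) → (∀ z → z ≢ x ⊗ y → F z ≡ 0) →
    ∑ (concatMap (λ x′ → map (x′ ⊗_) ys) xs) F ≡ F (x ⊗ y)
  ∑-concatMap-⊗ F x y F≗0 = begin
    ∑ (concatMap (λ x′ → map (x′ ⊗_) ys) xs) F  ≡⟨ ∑-concatMap xs _ F ⟩
    ∑ xs (λ x′ → ∑ (map (x′ ⊗_) ys) F)          ≡⟨ ∑-pick xs-enum _ x other-row ⟩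
    ∑ (map (x ⊗_) ys) F                         ≡⟨ ∑-map ys (x ⊗_) F ⟩
    ∑ ys (λ y′ → F (x ⊗ y′))                    ≡⟨ ∑-pick ys-enum _ y other-column ⟩
    F (x ⊗ y)                                   ∎
    where
    open ≡-Reasoning
    other-row : ∀ x′ → x′ ≢ x → ∑ (map (x′ ⊗_) ys) F ≡ 0
    other-row x′ x′≢x =
      trans (∑-map ys (x′ ⊗_) F) (∑-zero ys (λ y′ → F≗0 _ (x′≢x ∘ proj₁ ∘ ⊗-injective)))
    other-column : ∀ y′ → y′ ≢ y → F (x ⊗ y′) ≡ 0
    other-column y′ y′≢y = F≗0 _ (y′≢y ∘ proj₂ ∘ ⊗-injective)

enumerates-product : {xs : List X} {ys : List Y} → Enumerates xs → Enumerates ys →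
  Enumerates (concatMap (λ x → map (x ,_) ys) xs)
enumerates-product xs-enum ys-enum = enumerates λ F (x , y) →
  ∑-concatMap-⊗ _,_ Product.,-injective xs-enum ys-enum F x y

enumerates-bools : Enumerates (true ∷ false ∷ [])
enumerates-bools = enumerates pick
  where
  pick : (F : Bool → ℕ) (b : Bool) → (∀ b′ → b′ ≢ b → F b′ ≡ 0) → ∑ (true ∷ false ∷ []) F ≡ F b
  pick F true  F≗0 = trans (cong (λ z → F true + (z + 0)) (F≗0 false λ ())) (+-identityʳ _)
  pick F false F≗0 = trans (cong (_+ (F false + 0)) (F≗0 true λ ())) (+-identityʳ _)

enumerates-allBoolVecs : (k : ℕ) → Enumerates (allBoolVecs k)
enumerates-allBoolVecs zero    = enumerates λ { F [] _ → +-identityʳ (F []) }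
enumerates-allBoolVecs (suc k) = enumerates λ { F (b ∷ v) →
  ∑-concatMap-⊗ _∷_ Vec.∷-injective enumerates-bools (enumerates-allBoolVecs k) F b v }

enumerates-allFin : (k : ℕ) → Enumerates (allFin k)
enumerates-allFin k = enumerates (pick k)
  where
  pick : (k : ℕ) (F : Fin k → ℕ) (i : Fin k) → (∀ j → j ≢ i → F j ≡ 0) → ∑ (allFin k) F ≡ F i
  pick (suc k) F zero    F≗0 =
    trans (cong (F zero +_) (trans (∑-map (allFin k) suc F) (∑-zero (allFin k) (λ j → F≗0 (suc j) λ ()))))
          (+-identityʳ _)
  pick (suc k) F (suc i) F≗0 =
    trans (cong₂ _+_ (F≗0 zero λ ()) (∑-map (allFin k) suc F))
          (pick k (F ∘ suc) i (λ j j≢i → F≗0 (suc j) (j≢i ∘ Fin.suc-injective)))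

enumerates-allOneTps : (n m : ℕ) → Enumerates (allOneTps n m)
enumerates-allOneTps n m = enumerates-product (enumerates-allBoolVecs n) (enumerates-allBoolVecs m)

enumerates-allTwoTps : (m : ℕ) → Enumerates (allTwoTps m)
enumerates-allTwoTps m = enumerates-product (enumerates-allBoolVecs m) (enumerates-allBoolVecs m)

enumerates-nonempty : {xs : List X} → Enumerates xs → DecidableEquality X → X → ¬ xs ≡ []
enumerates-nonempty {xs = xs} xs-enum _≟_ x xs≡[] = 0≢1+n (begin
  0                            ≡⟨ sym (cong (λ xs → ∑ xs (λ y → 𝟙 (y ≟ x))) xs≡[]) ⟩
  ∑ xs (λ y → 𝟙 (y ≟ x))       ≡⟨ ∑-pick xs-enum _ x (λ y y≢x → 𝟙-no (y ≟ x) y≢x) ⟩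
  𝟙 (x ≟ x)                    ≡⟨ 𝟙-yes (x ≟ x) refl ⟩
  1                            ∎)
  where open ≡-Reasoning

∑-𝟙-unique : {xs : List X} → Enumerates xs → {P : X → Set} (P? : ∀ x → Dec (P x)) {Q : Set} (Q? : Dec Q) →
  (∀ x → P x → Q) → (Q → Σ X λ x → P x × (∀ y → P y → y ≡ x)) → ∑ xs (λ x → 𝟙 (P? x)) ≡ 𝟙 Q?
∑-𝟙-unique {xs = xs} xs-enum P? (yes q) P⇒Q Q⇒unique with Q⇒unique q
... | x , Px , only-x =
  trans (∑-pick xs-enum _ x (λ y y≢x → 𝟙-no (P? y) (y≢x ∘ only-x y))) (𝟙-yes (P? x) Px)
∑-𝟙-unique {xs = xs} xs-enum P? (no ¬q) P⇒Q Q⇒unique = ∑-zero xs (λ y → 𝟙-no (P? y) (¬q ∘ P⇒Q y))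

term≤∑ : {xs : List X} → Enumerates xs → DecidableEquality X → (F : X → ℕ) (x : X) → F x ≤ ∑ xs F
term≤∑ {xs = xs} xs-enum _≟_ F x = begin
  F x                           ≡⟨ sym (𝟙-*-yes (x ≟ x) refl (F x)) ⟩
  𝟙 (x ≟ x) * F x               ≡⟨ sym (∑-pick xs-enum (λ y → 𝟙 (y ≟ x) * F y) x
                                         (λ y y≢x → cong (_* F y) (𝟙-no (y ≟ x) y≢x))) ⟩
  ∑ xs (λ y → 𝟙 (y ≟ x) * F y)  ≤⟨ ∑-mono-≤ xs (λ y → 𝟙-*-≤ (y ≟ x) (F y)) ⟩
  ∑ xs F                        ∎
  where open ≤-Reasoning

∑< : ℕ → (ℕ → ℕ) → ℕ
∑< zero    F = 0
∑< (suc n) F = F 0 + ∑< n (F ∘ suc)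

∑<-+ : (a b : ℕ) (F : ℕ → ℕ) → ∑< (a + b) F ≡ ∑< a F + ∑< b (λ q → F (a + q))
∑<-+ zero    b F = refl
∑<-+ (suc a) b F = trans (cong (F 0 +_) (∑<-+ a b (F ∘ suc))) (sym (+-assoc (F 0) _ _))

∑<-cong : (n : ℕ) {F G : ℕ → ℕ} → (∀ q → q < n → F q ≡ G q) → ∑< n F ≡ ∑< n G
∑<-cong zero    F≗G = refl
∑<-cong (suc n) F≗G = cong₂ _+_ (F≗G 0 (s≤s z≤n)) (∑<-cong n (λ q q<n → F≗G (suc q) (s≤s q<n)))

∑<-const : (n c : ℕ) → ∑< n (λ _ → c) ≡ n * c
∑<-const zero    c = refl
∑<-const (suc n) c = cong (c +_) (∑<-const n c)

∑<-restrict : {N P : ℕ} → N ≤ P → (F : ℕ → ℕ) → ∑< P (λ q → 𝟙 (q <? N) * F q) ≡ ∑< N F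
∑<-restrict {N} {P} N≤P F = begin
  ∑< P G                                 ≡⟨ cong (λ P → ∑< P G) (sym (m+[n∸m]≡n N≤P)) ⟩
  ∑< (N + (P ∸ N)) G                     ≡⟨ ∑<-+ N (P ∸ N) G ⟩
  ∑< N G + ∑< (P ∸ N) (λ q → G (N + q))  ≡⟨ cong₂ _+_ (∑<-cong N below) (∑<-cong (P ∸ N) above) ⟩
  ∑< N F + ∑< (P ∸ N) (λ _ → 0)          ≡⟨ cong (∑< N F +_) (trans (∑<-const (P ∸ N) 0) (*-zeroʳ (P ∸ N))) ⟩
  ∑< N F + 0                             ≡⟨ +-identityʳ _ ⟩
  ∑< N F                                 ∎
  where
  open ≡-Reasoning
  G : ℕ → ℕ
  G q = 𝟙 (q <? N) * F q
  below : ∀ q → q < N → G q ≡ F q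
  below q q<N = 𝟙-*-yes (q <? N) q<N (F q)
  above : ∀ q → q < P ∸ N → G (N + q) ≡ 0
  above q _ = cong (_* F (N + q)) (𝟙-no (N + q <? N) (m+n≮m N q))

∑-allFin-toℕ : (k : ℕ) (F : ℕ → ℕ) → ∑ (allFin k) (F ∘ toℕ) ≡ ∑< k F
∑-allFin-toℕ zero    F = refl
∑-allFin-toℕ (suc k) F =
  cong (F 0 +_) (trans (∑-map (allFin k) suc (F ∘ toℕ)) (∑-allFin-toℕ k (F ∘ suc)))

-- Cutting [0, sum ws) into consecutive blocks of the lengths listed in ws,
-- blockOf ws p is the index of the block containing p.
blockOf : List ℕ → ℕ → ℕ
blockOf []       p = 0
blockOf (w ∷ ws) p with p <? w
... | yes _ = 0
... | no  _ = suc (blockOf ws (p ∸ w))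

nth : List ℕ → ℕ → ℕ
nth []       j       = 0
nth (w ∷ ws) zero    = w
nth (w ∷ ws) (suc j) = nth ws j

blockOf-< : (w : ℕ) (ws : List ℕ) {p : ℕ} → p < w → blockOf (w ∷ ws) p ≡ 0
blockOf-< w ws {p} p<w with p <? w
... | yes _   = refl
... | no  p≮w = ⊥-elim (p≮w p<w)

blockOf-+ : (w : ℕ) (ws : List ℕ) (q : ℕ) → blockOf (w ∷ ws) (w + q) ≡ suc (blockOf ws q)
blockOf-+ w ws q with w + q <? w
... | yes w+q<w = ⊥-elim (m+n≮m w q w+q<w)
... | no  _     = cong (suc ∘ blockOf ws) (m+n∸m≡n w q)

blockOf-size : (ws : List ℕ) (j : ℕ) → ∑< (sumℕ ws) (λ p → 𝟙 (blockOf ws p ≟ j)) ≡ nth ws j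
blockOf-size []       j = refl
blockOf-size (w ∷ ws) j =
  trans (∑<-+ w (sumℕ ws) (λ p → 𝟙 (blockOf (w ∷ ws) p ≟ j))) (split j)
  where
  split : (j : ℕ) → ∑< w (λ p → 𝟙 (blockOf (w ∷ ws) p ≟ j))
                    + ∑< (sumℕ ws) (λ q → 𝟙 (blockOf (w ∷ ws) (w + q) ≟ j)) ≡ nth (w ∷ ws) j
  split zero = begin
    _                                   ≡⟨ cong₂ _+_ (∑<-cong w (λ p p<w → cong (λ b → 𝟙 (b ≟ 0)) (blockOf-< w ws p<w)))
                                                     (∑<-cong (sumℕ ws) (λ q _ → cong (λ b → 𝟙 (b ≟ 0)) (blockOf-+ w ws q))) ⟩
    ∑< w (λ _ → 1) + ∑< (sumℕ ws) (λ _ → 0)  ≡⟨ cong₂ _+_ (trans (∑<-const w 1) (*-identityʳ w))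
                                                           (trans (∑<-const (sumℕ ws) 0) (*-zeroʳ (sumℕ ws))) ⟩
    w + 0                               ≡⟨ +-identityʳ w ⟩
    w                                   ∎
    where open ≡-Reasoning
  split (suc j) = begin
    _                                   ≡⟨ cong₂ _+_ (∑<-cong w (λ p p<w → cong (λ b → 𝟙 (b ≟ suc j)) (blockOf-< w ws p<w)))
                                                     (∑<-cong (sumℕ ws) (λ q _ → later-block q)) ⟩
    ∑< w (λ _ → 0) + ∑< (sumℕ ws) (λ q → 𝟙 (blockOf ws q ≟ j))
                                        ≡⟨ cong₂ _+_ (trans (∑<-const w 0) (*-zeroʳ w)) (blockOf-size ws j) ⟩
    nth ws j                            ∎
    where
    open ≡-Reasoning
    later-block : (q : ℕ) → 𝟙 (blockOf (w ∷ ws) (w + q) ≟ suc j) ≡ 𝟙 (blockOf ws q ≟ j)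
    later-block q = trans (cong (λ b → 𝟙 (b ≟ suc j)) (blockOf-+ w ws q)) (𝟙-cong _ _ suc-injective (cong suc))

nth-blockOf-pos : (ws : List ℕ) {p : ℕ} → p < sumℕ ws → 0 < nth ws (blockOf ws p)
nth-blockOf-pos (w ∷ ws) {p} p<sum with p <? w
... | yes p<w = ≤-trans (s≤s z≤n) p<w
... | no  p≮w = nth-blockOf-pos ws (+-cancelˡ-< w (p ∸ w) (sumℕ ws) w+[p∸w]<w+sum)
  where
  w+[p∸w]<w+sum : w + (p ∸ w) < w + sumℕ ws
  w+[p∸w]<w+sum = subst (_< w + sumℕ ws) (sym (m+[n∸m]≡n (≮⇒≥ p≮w))) p<sum

nth-pos⇒< : (ws : List ℕ) (j : ℕ) → 0 < nth ws j → j < length ws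
nth-pos⇒< (w ∷ ws) zero    _   = s≤s z≤n
nth-pos⇒< (w ∷ ws) (suc j) pos = s≤s (nth-pos⇒< ws j pos)

nth-map : (F : X → ℕ) (xs : List X) (j : Fin (length xs)) → nth (map F xs) (toℕ j) ≡ F (Data.List.lookup xs j)
nth-map F (x ∷ xs) zero    = refl
nth-map F (x ∷ xs) (suc j) = nth-map F xs j

_≟ᵥ_ : {k : ℕ} → DecidableEquality (Vec Bool k)
_≟ᵥ_ = Vec.≡-dec Bool._≟_

_≟₁_ : {n m : ℕ} → DecidableEquality (OneTp n m)
_≟₁_ = Product.≡-dec _≟ᵥ_ _≟ᵥ_

_≟₂_ : {m : ℕ} → DecidableEquality (TwoTp m)
_≟₂_ = Product.≡-dec _≟ᵥ_ _≟ᵥ_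

module _ {n m k : ℕ} (A : Structure n m k) where

  oneType : Fin k → OneTp n m
  oneType a = tabulate (λ i → U A i a) , tabulate (λ i → R A i a a)

  twoType : Fin k → Fin k → TwoTp m
  twoType a b = tabulate (λ i → R A i a b) , tabulate (λ i → R A i b a)

  realizes-oneType : (a : Fin k) → Realizes₁ A a (oneType a)
  realizes-oneType a = (λ i → sym (Vec.lookup∘tabulate _ i)) , (λ i → sym (Vec.lookup∘tabulate _ i))

  realizes-twoType : (a b : Fin k) → Realizes₂ A a b (twoType a b)
  realizes-twoType a b = (λ i → sym (Vec.lookup∘tabulate _ i)) , (λ i → sym (Vec.lookup∘tabulate _ i))

  private
    tabulate-≗-lookup : {l : ℕ} {f : Fin l → Bool} (v : Vec Bool l) → (∀ i → f i ≡ lookup v i) → tabulate f ≡ v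
    tabulate-≗-lookup v f≗v = trans (Vec.tabulate-cong f≗v) (Vec.tabulate∘lookup v)

  oneType-unique : {a : Fin k} {π : OneTp n m} → Realizes₁ A a π → oneType a ≡ π
  oneType-unique {π = u , r} (a-u , a-r) = cong₂ _,_ (tabulate-≗-lookup u a-u) (tabulate-≗-lookup r a-r)

  twoType-unique : {a b : Fin k} {η : TwoTp m} → Realizes₂ A a b η → twoType a b ≡ η
  twoType-unique {η = f , b} (ab-f , ab-b) = cong₂ _,_ (tabulate-≗-lookup f ab-f) (tabulate-≗-lookup b ab-b)

RealizesPair : {n m k : ℕ} → Structure n m k → Fin k → Fin k → OneTp n m → TwoTp m → OneTp n m → Set
RealizesPair A a b π₁ η π₂ = Realizes₁ A a π₁ × Realizes₂ A a b η × Realizes₁ A b π₂ × a ≢ b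

module _ {n m k k′ : ℕ} (A : Structure n m k) (B : Structure n m k′) where

  eval-invariant₁ : {a : Fin k} {b : Fin k′} (π : OneTp n m) → Realizes₁ A a π → Realizes₁ B b π →
    (ψ : QF n m 1) → eval A (λ _ → a) ψ ≡ eval B (λ _ → b) ψ
  eval-invariant₁ {a} {b} π a-π b-π = go
    where
    go : (ψ : QF n m 1) → eval A (λ _ → a) ψ ≡ eval B (λ _ → b) ψ
    go tt          = refl
    go (atU i _)   = trans (proj₁ a-π i) (sym (proj₁ b-π i))
    go (atR i _ _) = trans (proj₂ a-π i) (sym (proj₂ b-π i))
    go (atEq _ _)  = trans (⌊⌋-yes (a Fin.≟ a) refl) (sym (⌊⌋-yes (b Fin.≟ b) refl))
    go (neg ψ)     = cong not (go ψ)
    go (and ψ χ)   = cong₂ _∧_ (go ψ) (go χ)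
    go (or ψ χ)    = cong₂ _∨_ (go ψ) (go χ)

  eval-invariant₂ : {a b : Fin k} {a′ b′ : Fin k′} (π₁ : OneTp n m) (η : TwoTp m) (π₂ : OneTp n m) →
    RealizesPair A a b π₁ η π₂ → RealizesPair B a′ b′ π₁ η π₂ →
    (ψ : QF n m 2) → eval A (env₂ a b) ψ ≡ eval B (env₂ a′ b′) ψ
  eval-invariant₂ {a} {b} {a′} {b′} _ _ _ (a-π₁ , ab-η , b-π₂ , a≢b) (a′-π₁ , ab′-η , b′-π₂ , a′≢b′) = go
    where
    go : (ψ : QF n m 2) → eval A (env₂ a b) ψ ≡ eval B (env₂ a′ b′) ψ
    go tt                           = refl
    go (atU i zero)                 = trans (proj₁ a-π₁ i) (sym (proj₁ a′-π₁ i))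
    go (atU i (suc zero))           = trans (proj₁ b-π₂ i) (sym (proj₁ b′-π₂ i))
    go (atR i zero zero)            = trans (proj₂ a-π₁ i) (sym (proj₂ a′-π₁ i))
    go (atR i zero (suc zero))      = trans (proj₁ ab-η i) (sym (proj₁ ab′-η i))
    go (atR i (suc zero) zero)      = trans (proj₂ ab-η i) (sym (proj₂ ab′-η i))
    go (atR i (suc zero) (suc zero)) = trans (proj₂ b-π₂ i) (sym (proj₂ b′-π₂ i))
    go (atEq zero zero)             = trans (⌊⌋-yes (a Fin.≟ a) refl) (sym (⌊⌋-yes (a′ Fin.≟ a′) refl))
    go (atEq zero (suc zero))       = trans (⌊⌋-no (a Fin.≟ b) a≢b) (sym (⌊⌋-no (a′ Fin.≟ b′) a′≢b′))
    go (atEq (suc zero) zero)       = trans (⌊⌋-no (b Fin.≟ a) (a≢b ∘ sym)) (sym (⌊⌋-no (b′ Fin.≟ a′) (a′≢b′ ∘ sym)))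
    go (atEq (suc zero) (suc zero)) = trans (⌊⌋-yes (b Fin.≟ b) refl) (sym (⌊⌋-yes (b′ Fin.≟ b′) refl))
    go (neg ψ)                      = cong not (go ψ)
    go (and ψ χ)                    = cong₂ _∧_ (go ψ) (go χ)
    go (or ψ χ)                     = cong₂ _∨_ (go ψ) (go χ)

module _ {n m : ℕ} (φ : GP2 n m) where

  private
    point : OneTp n m → Structure n m 1
    point (u , r) = record { U = λ i _ → lookup u i ; R = λ i _ _ → lookup r i }

    realizes-point : (π : OneTp n m) → Realizes₁ (point π) zero π
    realizes-point π = (λ _ → refl) , (λ _ → refl)

    edge : OneTp n m → TwoTp m → OneTp n m → Structure n m 2
    edge (u₁ , r₁) (f , b) (u₂ , r₂) = record { U = U′ ; R = R′ }
      where
      U′ : Fin n → Fin 2 → Bool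
      U′ i zero       = lookup u₁ i
      U′ i (suc zero) = lookup u₂ i
      R′ : Fin m → Fin 2 → Fin 2 → Bool
      R′ i zero       zero       = lookup r₁ i
      R′ i zero       (suc zero) = lookup f i
      R′ i (suc zero) zero       = lookup b i
      R′ i (suc zero) (suc zero) = lookup r₂ i

    realizes-edge : (π₁ : OneTp n m) (η : TwoTp m) (π₂ : OneTp n m) →
      RealizesPair (edge π₁ η π₂) zero (suc zero) π₁ η π₂
    realizes-edge π₁ η π₂ = ((λ _ → refl) , (λ _ → refl)) , ((λ _ → refl) , (λ _ → refl))
                          , ((λ _ → refl) , (λ _ → refl)) , (λ ())

  -- Both properties quantify over all structures; by eval-invariance it suffices to evaluate in the
  -- one- or two-element structure realizing the given types.
  inOneTps? : (π : OneTp n m) → Dec (InOneTps φ π)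
  inOneTps? π = map′
    (λ γ-true _ A a a-π → trans (eval-invariant₁ A (point π) π a-π (realizes-point π) (γ φ)) γ-true)
    (λ π-ok → π-ok 1 (point π) zero (realizes-point π))
    (eval (point π) (λ _ → zero) (γ φ) Bool.≟ true)

  entails? : (π₁ : OneTp n m) (η : TwoTp m) (π₂ : OneTp n m) → Dec (Entails φ π₁ η π₂)
  entails? π₁ η π₂ = map′
    (λ α-true _ A a b a-π₁ ab-η b-π₂ i Rab a≢b →
       trans (eval-invariant₂ A C π₁ η π₂ (a-π₁ , ab-η , b-π₂ , a≢b) C-edge (α φ i))
             (α-true i (trans (sym (proj₁ ab-η i)) Rab)))
    (λ ent i ηᵢ → let (c-π₁ , c-η , c-π₂ , _) = C-edge in ent 2 C zero (suc zero) c-π₁ c-η c-π₂ i ηᵢ λ ())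
    (Fin.all? λ i → (lookup (proj₁ η) i Bool.≟ true) →-dec (eval C (env₂ zero (suc zero)) (α φ i) Bool.≟ true))
    where
    C = edge π₁ η π₂
    C-edge = realizes-edge π₁ η π₂

  compatible? : (π₁ : OneTp n m) (η : TwoTp m) (π₂ : OneTp n m) → Dec (Compatible φ π₁ η π₂)
  compatible? π₁ η π₂ = entails? π₁ η π₂ ×-dec entails? π₂ (dual η) π₁

anyTrue-lookup : {k : ℕ} (v : Vec Bool k) (t : Fin k) → lookup v t ≡ true → T (anyTrue v)
anyTrue-lookup (true  ∷ v) zero    _  = _
anyTrue-lookup (true  ∷ v) (suc t) _  = _
anyTrue-lookup (false ∷ v) (suc t) vₜ = anyTrue-lookup v t vₜ

audible-lookup : {m : ℕ} (η : TwoTp m) (t : Fin m) → lookup (proj₁ η) t ≡ true → T (audible η)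
audible-lookup (f , b) t fₜ with anyTrue f | anyTrue-lookup f t fₜ
... | true | _ = _

audible-dual : {m : ℕ} (η : TwoTp m) → T (audible η) → T (audible (dual η))
audible-dual (f , b) = subst T (Bool.∨-comm (anyTrue f) (anyTrue b))

module _ {n m : ℕ} where

  ext-audible : (f : BVec n m) (η : TwoTp m) (π : OneTp n m) (η-aud : T (audible η)) → ext f η π ≡ f (η , η-aud) π
  ext-audible f η π η-aud with T? (audible η)
  ... | yes η-aud′ = cong (λ p → f (η , p) π) (Bool.T-irrelevant η-aud′ η-aud)
  ... | no  ¬aud   = ⊥-elim (¬aud η-aud)

  ext-cong : {f f′ : BVec n m} → f ≈B f′ → (η : TwoTp m) (π : OneTp n m) → ext f η π ≡ ext f′ η π
  ext-cong f≈f′ η π with T? (audible η)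
  ... | yes η-aud = f≈f′ (η , η-aud) π
  ... | no  _     = refl

  ext-positive : (f : BVec n m) (η : TwoTp m) (π : OneTp n m) → 0 < ext f η π →
    Σ (T (audible η)) λ η-aud → 0 < f (η , η-aud) π
  ext-positive f η π pos with T? (audible η)
  ... | yes η-aud = η-aud , pos

  sumB-apply : (fs : List (BVec n m)) (η : TwoTp⁺ m) (π : OneTp n m) → sumB fs η π ≡ ∑ fs (λ f → f η π)
  sumB-apply []       η π = refl
  sumB-apply (f ∷ fs) η π = cong (f η π +_) (sumB-apply fs η π)

  ext-sumB : (fs : List (BVec n m)) (η : TwoTp m) (π : OneTp n m) → ext (sumB fs) η π ≡ ∑ fs (λ f → ext f η π)
  ext-sumB fs η π with T? (audible η)
  ... | yes η-aud = sumB-apply fs (η , η-aud) π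
  ... | no  _     = sym (∑-zero fs (λ _ → refl))

  ext-dual : {f f′ : BVec n m} {π π′ : OneTp n m} → (∀ η → f η π′ ≡ f′ (dual⁺ η) π) →
    (η : TwoTp m) → ext f η π′ ≡ ext f′ (dual η) π
  ext-dual {f} {f′} {π} {π′} f≡f′ η with T? (audible η) | T? (audible (dual η))
  ... | yes η-aud | yes η̄-aud = trans (f≡f′ (η , η-aud)) (cong (λ p → f′ (dual η , p) π) (Bool.T-irrelevant _ _))
  ... | yes η-aud | no ¬η̄-aud = ⊥-elim (¬η̄-aud (audible-dual η η-aud))
  ... | no ¬η-aud | yes η̄-aud = ⊥-elim (¬η-aud (audible-dual (dual η) η̄-aud))
  ... | no _      | no _      = refl

  linSum-cong : (φ : GP2 n m) (i : Fin n) {f f′ : BVec n m} → f ≈B f′ → linSum φ i f ≡ linSum φ i f′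
  linSum-cong φ i f≈f′ = cong sumℤ (List.map-cong (λ t → cong (λ c → lam φ i t ℤ.* (ℤ.+ c))
    (∑-cong (allTwoTps m) (λ η → cong (λ c → if lookup (proj₁ η) t then c else 0)
      (∑-cong (allOneTps n m) (ext-cong f≈f′ η))))) (allFin m))

  InB-resp-≈B : (φ : GP2 n m) (π : OneTp n m) {f f′ : BVec n m} → f ≈B f′ → InB φ π f → InB φ π f′
  InB-resp-≈B φ π f≈f′ (f-types , f-compatible , f-counts) =
      (λ η π′ ¬π′ → trans (sym (f≈f′ η π′)) (f-types η π′ ¬π′))
    , (λ η π′ ¬compat → trans (sym (f≈f′ η π′)) (f-compatible η π′ ¬compat))
    , (λ i Uᵢ → subst (λ s → holdsCmp (cmp φ i) s (δ φ i)) (linSum-cong φ i f≈f′) (f-counts i Uᵢ))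

module _ {n m k : ℕ} (A : Structure n m k) where

  Neighbour : Fin k → TwoTp m → OneTp n m → Fin k → Set
  Neighbour a η π b = a ≢ b × twoType A a b ≡ η × oneType A b ≡ π

  neighbour? : (a : Fin k) (η : TwoTp m) (π : OneTp n m) (b : Fin k) → Dec (Neighbour a η π b)
  neighbour? a η π b = ¬? (a Fin.≟ b) ×-dec (twoType A a b ≟₂ η ×-dec oneType A b ≟₁ π)

  behaviour : Fin k → TwoTp m → OneTp n m → ℕ
  behaviour a η π = ∑ (allFin k) (𝟙 ∘ neighbour? a η π)

  behaviourB : Fin k → BVec n m
  behaviourB a η π = behaviour a (proj₁ η) π

  countR-behaviour : (t : Fin m) (a : Fin k) →
    countR A t a ≡ ∑ (allTwoTps m) (λ η → if lookup (proj₁ η) t then ∑ (allOneTps n m) (behaviour a η) else 0)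
  countR-behaviour t a = sym (begin
    ∑ (allTwoTps m) (λ η → if lookup (proj₁ η) t then ∑ (allOneTps n m) (behaviour a η) else 0)
      ≡⟨ ∑-cong (allTwoTps m) (λ η → sym (∑-if (allOneTps n m) _ (behaviour a η))) ⟩
    ∑ (allTwoTps m) (λ η → ∑ (allOneTps n m) (λ π → if lookup (proj₁ η) t then behaviour a η π else 0))
      ≡⟨ ∑-cong (allTwoTps m) (λ η → ∑-cong (allOneTps n m) (λ π → sym (∑-if (allFin k) _ (𝟙 ∘ neighbour? a η π)))) ⟩
    ∑ (allTwoTps m) (λ η → ∑ (allOneTps n m) (λ π → ∑ (allFin k) (term η π)))
      ≡⟨ ∑-cong (allTwoTps m) (λ η → ∑-comm (allOneTps n m) (allFin k) (term η)) ⟩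
    ∑ (allTwoTps m) (λ η → ∑ (allFin k) (λ b → ∑ (allOneTps n m) (λ π → term η π b)))
      ≡⟨ ∑-comm (allTwoTps m) (allFin k) _ ⟩
    ∑ (allFin k) (λ b → ∑ (allTwoTps m) (λ η → ∑ (allOneTps n m) (λ π → term η π b)))
      ≡⟨ ∑-cong (allFin k) only-twoType-and-oneType-of-b ⟩
    countR A t a ∎)
    where
    open ≡-Reasoning
    term : TwoTp m → OneTp n m → Fin k → ℕ
    term η π b = if lookup (proj₁ η) t then 𝟙 (neighbour? a η π b) else 0

    if-0 : (c : Bool) {x : ℕ} → x ≡ 0 → (if c then x else 0) ≡ 0
    if-0 false _   = refl
    if-0 true  x≡0 = x≡0

    if-𝟙-¬ : (c : Bool) {P : Set} (d : Dec P) → (if c then 𝟙 (¬? d) else 0) ≡ (if c ∧ not ⌊ d ⌋ then 1 else 0)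
    if-𝟙-¬ false d      = refl
    if-𝟙-¬ true  (yes _) = refl
    if-𝟙-¬ true  (no _)  = refl

    only-twoType-and-oneType-of-b : (b : Fin k) →
      ∑ (allTwoTps m) (λ η → ∑ (allOneTps n m) (λ π → term η π b)) ≡ (if R A t a b ∧ not ⌊ a Fin.≟ b ⌋ then 1 else 0)
    only-twoType-and-oneType-of-b b = begin
      ∑ (allTwoTps m) (λ η → ∑ (allOneTps n m) (λ π → term η π b))
        ≡⟨ ∑-pick (enumerates-allTwoTps m) _ (twoType A a b)
             (λ η η≢ → ∑-zero (allOneTps n m) λ π →
                         if-0 (lookup (proj₁ η) t) (𝟙-no _ (η≢ ∘ sym ∘ proj₁ ∘ proj₂))) ⟩
      ∑ (allOneTps n m) (λ π → term (twoType A a b) π b)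
        ≡⟨ ∑-pick (enumerates-allOneTps n m) _ (oneType A b)
             (λ π π≢ → if-0 (lookup (proj₁ (twoType A a b)) t) (𝟙-no _ (π≢ ∘ sym ∘ proj₂ ∘ proj₂))) ⟩
      term (twoType A a b) (oneType A b) b
        ≡⟨ cong₂ (λ c x → if c then x else 0) (Vec.lookup∘tabulate (λ i → R A i a b) t)
                 (𝟙-cong _ (¬? (a Fin.≟ b)) proj₁ (λ a≢b → a≢b , refl , refl)) ⟩
      (if R A t a b then 𝟙 (¬? (a Fin.≟ b)) else 0)
        ≡⟨ if-𝟙-¬ (R A t a b) (a Fin.≟ b) ⟩
      (if R A t a b ∧ not ⌊ a Fin.≟ b ⌋ then 1 else 0) ∎

  linSum-behaviourB : (φ : GP2 n m) (i : Fin n) (a : Fin k) →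
    linSum φ i (behaviourB a) ≡ sumℤ (map (λ t → lam φ i t ℤ.* (ℤ.+ countR A t a)) (allFin m))
  linSum-behaviourB φ i a = cong sumℤ (List.map-cong (λ t → cong (λ c → lam φ i t ℤ.* (ℤ.+ c))
    (trans (∑-cong (allTwoTps m) (ext-behaviour t)) (sym (countR-behaviour t a)))) (allFin m))
    where
    ext-behaviour : (t : Fin m) (η : TwoTp m) →
        (if lookup (proj₁ η) t then ∑ (allOneTps n m) (ext (behaviourB a) η) else 0)
      ≡ (if lookup (proj₁ η) t then ∑ (allOneTps n m) (behaviour a η) else 0)
    ext-behaviour t η with lookup (proj₁ η) t in ηₜ
    ... | false = refl
    ... | true  = ∑-cong (allOneTps n m) (λ π → ext-audible (behaviourB a) η π (audible-lookup η t ηₜ))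

-- From a finite model to behaviour vectors

module FromModel {n m : ℕ} (φ : GP2 n m) {k : ℕ} (A : Structure n m (suc k)) (A⊨φ : A ⊨ φ) where

  oneType-inOneTps : (a : Fin (suc k)) → InOneTps φ (oneType A a)
  oneType-inOneTps a _ B b b-π =
    trans (eval-invariant₁ B A (oneType A a) b-π (realizes-oneType A a) (γ φ)) (proj₁ A⊨φ a)

  entails-twoType : {a b : Fin (suc k)} → a ≢ b → Entails φ (oneType A a) (twoType A a b) (oneType A b)
  entails-twoType {a} {b} a≢b _ B a′ b′ a′-π₁ a′b′-η b′-π₂ i Rᵢa′b′ a′≢b′ =
    trans (eval-invariant₂ B A (oneType A a) (twoType A a b) (oneType A b) (a′-π₁ , a′b′-η , b′-π₂ , a′≢b′)
                                     (realizes-oneType A a , realizes-twoType A a b , realizes-oneType A b , a≢b) (α φ i))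
          (proj₁ (proj₂ A⊨φ) i a b (trans (proj₁ (realizes-twoType A a b) i) (trans (sym (proj₁ a′b′-η i)) Rᵢa′b′)) a≢b)

  compatible-twoType : {a b : Fin (suc k)} → a ≢ b → Compatible φ (oneType A a) (twoType A a b) (oneType A b)
  compatible-twoType a≢b = entails-twoType a≢b , entails-twoType (a≢b ∘ sym)

  behaviour-in-B : (a : Fin (suc k)) → InB φ (oneType A a) (behaviourB A a)
  behaviour-in-B a = only-OneTps , only-compatible , counting
    where
    only-OneTps : (η : TwoTp⁺ m) (π : OneTp n m) → ¬ InOneTps φ π → behaviourB A a η π ≡ 0
    only-OneTps η π ¬π = ∑-zero (allFin (suc k)) λ b → 𝟙-no (neighbour? A a (proj₁ η) π b)
      λ (_ , _ , b-π) → ¬π (subst (InOneTps φ) b-π (oneType-inOneTps b))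
    only-compatible : (η : TwoTp⁺ m) (π : OneTp n m) → ¬ Compatible φ (oneType A a) (proj₁ η) π → behaviourB A a η π ≡ 0
    only-compatible η π ¬compat = ∑-zero (allFin (suc k)) λ b → 𝟙-no (neighbour? A a (proj₁ η) π b)
      λ (a≢b , ab-η , b-π) → ¬compat (subst₂ (Compatible φ (oneType A a)) ab-η b-π (compatible-twoType a≢b))
    counting : (i : Fin n) → lookup (proj₁ (oneType A a)) i ≡ true →
      holdsCmp (cmp φ i) (linSum φ i (behaviourB A a)) (δ φ i)
    counting i Uᵢa = subst (λ s → holdsCmp (cmp φ i) s (δ φ i)) (sym (linSum-behaviourB A φ i a))
      (proj₂ (proj₂ A⊨φ) i a (trans (sym (Vec.lookup∘tabulate (λ i → U A i a) i)) Uᵢa))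

  ofType : OneTp n m → List (Fin (suc k))
  ofType π = filter (λ a → oneType A a ≟₁ π) (allFin (suc k))

  g : OneTp n m → BVec n m
  g π = sumB (map (behaviourB A) (ofType π))

  g-star : (π : OneTp n m) → Star (InB φ π) (g π)
  g-star π = map (behaviourB A) (ofType π)
           , All.map⁺ (All.map (λ {a} a-π → subst (λ π → InB φ π (behaviourB A a)) a-π (behaviour-in-B a))
                               (All.all-filter (λ a → oneType A a ≟₁ π) (allFin (suc k))))
           , (λ _ _ → refl)

  g-apply : (π : OneTp n m) (η : TwoTp⁺ m) (π′ : OneTp n m) →
    g π η π′ ≡ ∑ (allFin (suc k)) (λ a → 𝟙 (oneType A a ≟₁ π) * behaviourB A a η π′)
  g-apply π η π′ = begin
    sumB (map (behaviourB A) (ofType π)) η π′    ≡⟨ sumB-apply (map (behaviourB A) (ofType π)) η π′ ⟩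
    ∑ (map (behaviourB A) (ofType π)) (λ f → f η π′)  ≡⟨ ∑-map (ofType π) (behaviourB A) (λ f → f η π′) ⟩
    ∑ (ofType π) (λ a → behaviourB A a η π′)          ≡⟨ ∑-filter (λ a → oneType A a ≟₁ π) (allFin (suc k)) _ ⟩
    ∑ (allFin (suc k)) (λ a → 𝟙 (oneType A a ≟₁ π) * behaviourB A a η π′) ∎
    where open ≡-Reasoning

  Edge : OneTp n m → TwoTp m → OneTp n m → Fin (suc k) → Fin (suc k) → Set
  Edge π₁ η π₂ a b = oneType A a ≡ π₁ × Neighbour A a η π₂ b

  edge? : (π₁ : OneTp n m) (η : TwoTp m) (π₂ : OneTp n m) (a b : Fin (suc k)) → Dec (Edge π₁ η π₂ a b)
  edge? π₁ η π₂ a b = (oneType A a ≟₁ π₁) ×-dec neighbour? A a η π₂ b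

  edge-swap : {π₁ : OneTp n m} {η : TwoTp m} {π₂ : OneTp n m} {a b : Fin (suc k)} →
    Edge π₁ η π₂ a b → Edge π₂ (dual η) π₁ b a
  edge-swap (a-π₁ , a≢b , ab-η , b-π₂) = b-π₂ , a≢b ∘ sym , cong dual ab-η , a-π₁

  g-edges : (π₁ : OneTp n m) (η : TwoTp⁺ m) (π₂ : OneTp n m) →
    g π₁ η π₂ ≡ ∑ (allFin (suc k)) (λ a → ∑ (allFin (suc k)) (𝟙 ∘ edge? π₁ (proj₁ η) π₂ a))
  g-edges π₁ η π₂ = trans (g-apply π₁ η π₂) (∑-cong (allFin (suc k)) λ a →
    trans (sym (∑-*ˡ (allFin (suc k)) (𝟙 (oneType A a ≟₁ π₁)) (𝟙 ∘ neighbour? A a (proj₁ η) π₂)))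
          (∑-cong (allFin (suc k)) λ b →
      sym (𝟙-×-dec (oneType A a ≟₁ π₁) (neighbour? A a (proj₁ η) π₂ b))))

  g-matching : (π₁ : OneTp n m) (η : TwoTp⁺ m) (π₂ : OneTp n m) → g π₁ η π₂ ≡ g π₂ (dual⁺ η) π₁
  g-matching π₁ η π₂ = begin
    g π₁ η π₂
      ≡⟨ g-edges π₁ η π₂ ⟩
    ∑ (allFin (suc k)) (λ a → ∑ (allFin (suc k)) (𝟙 ∘ edge? π₁ (proj₁ η) π₂ a))
      ≡⟨ ∑-comm (allFin (suc k)) (allFin (suc k)) _ ⟩
    ∑ (allFin (suc k)) (λ b → ∑ (allFin (suc k)) (λ a → 𝟙 (edge? π₁ (proj₁ η) π₂ a b)))
      ≡⟨ ∑-cong (allFin (suc k)) (λ b → ∑-cong (allFin (suc k)) λ a → 𝟙-cong _ _ edge-swap edge-swap) ⟩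
    ∑ (allFin (suc k)) (λ b → ∑ (allFin (suc k)) (𝟙 ∘ edge? π₂ (dual (proj₁ η)) π₁ b))
      ≡⟨ sym (g-edges π₂ (dual⁺ η) π₁) ⟩
    g π₂ (dual⁺ η) π₁ ∎
    where open ≡-Reasoning

  g-nontrivial : ((π : OneTp n m) → InOneTps φ π → ¬ InB φ π zeroB) → ¬ (g (oneType A zero) ≈B zeroB)
  g-nontrivial 0∉B g≈0 = 0∉B π₀ (oneType-inOneTps zero)
    (InB-resp-≈B φ π₀ behaviour₀≈0 (behaviour-in-B zero))
    where
    π₀ = oneType A zero
    behaviour₀≈0 : behaviourB A zero ≈B zeroB
    behaviour₀≈0 η π′ = trans (sym (𝟙-*-yes (π₀ ≟₁ π₀) refl _))
      (m+n≡0⇒m≡0 _ (trans (sym (g-apply π₀ η π′)) (g≈0 η π′)))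

-- From behaviour vectors to a finite model

_⊕ᵥ_ : {l : ℕ} → Vec Bool l → Vec Bool l → Vec Bool l
_⊕ᵥ_ = Data.Vec.zipWith _xor_

⊕ᵥ-cancelʳ : {l : ℕ} (u v : Vec Bool l) → (u ⊕ᵥ v) ⊕ᵥ v ≡ u
⊕ᵥ-cancelʳ []      []      = refl
⊕ᵥ-cancelʳ (a ∷ u) (b ∷ v) = cong₂ _∷_
  (trans (Bool.xor-assoc a b b) (trans (cong (a xor_) (Bool.xor-same b)) (Bool.xor-identityʳ a)))
  (⊕ᵥ-cancelʳ u v)

⊕ᵥ-cancelˡ : {l : ℕ} (u v : Vec Bool l) → u ⊕ᵥ (u ⊕ᵥ v) ≡ v
⊕ᵥ-cancelˡ []      []      = refl
⊕ᵥ-cancelˡ (a ∷ u) (b ∷ v) = cong₂ _∷_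
  (trans (sym (Bool.xor-assoc a a b)) (cong (_xor b) (Bool.xor-same a)))
  (⊕ᵥ-cancelˡ u v)

oneHot : {l : ℕ} → Fin l → Vec Bool l
oneHot p = tabulate (λ i → ⌊ i Fin.≟ p ⌋)

oneHot-injective : {l : ℕ} {p q : Fin l} → oneHot p ≡ oneHot q → p ≡ q
oneHot-injective {p = p} {q} eq = toWitness {a? = p Fin.≟ q} (subst T (sym p≟q) _)
  where
  p≟q : ⌊ p Fin.≟ q ⌋ ≡ true
  p≟q = begin
    ⌊ p Fin.≟ q ⌋         ≡⟨ sym (Vec.lookup∘tabulate _ p) ⟩
    lookup (oneHot q) p  ≡⟨ cong (λ v → lookup v p) (sym eq) ⟩
    lookup (oneHot p) p  ≡⟨ Vec.lookup∘tabulate _ p ⟩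
    ⌊ p Fin.≟ p ⌋         ≡⟨ ⌊⌋-yes (p Fin.≟ p) refl ⟩
    true                 ∎
    where open ≡-Reasoning

firstIndex : (xs : List X) → ¬ xs ≡ [] → Fin (length xs)
firstIndex []      xs≢[] = ⊥-elim (xs≢[] refl)
firstIndex (_ ∷ _) _     = zero

length≡suc : (xs : List X) → ¬ xs ≡ [] → length xs ≡ suc (length xs ∸ 1)
length≡suc []      xs≢[] = ⊥-elim (xs≢[] refl)
length≡suc (_ ∷ _) _     = refl

silent : {m : ℕ} → TwoTp m
silent = Data.Vec.replicate _ false , Data.Vec.replicate _ false

anyTrue-replicate : (l : ℕ) → anyTrue (Data.Vec.replicate l false) ≡ false
anyTrue-replicate zero    = refl
anyTrue-replicate (suc l) = anyTrue-replicate l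

silent-inaudible : {m : ℕ} → ¬ T (audible (silent {m}))
silent-inaudible {m} aud rewrite anyTrue-replicate m = aud

orient : {m : ℕ} → Bool → TwoTp m → TwoTp m
orient false η = η
orient true  η = dual η

orient-involutive : {m : ℕ} (s : Bool) (η : TwoTp m) → orient s (orient s η) ≡ η
orient-involutive false η = refl
orient-involutive true  η = refl

orient-not-dual : {m : ℕ} (s : Bool) (η : TwoTp m) → orient (not s) (dual η) ≡ orient s η
orient-not-dual false η = refl
orient-not-dual true  η = refl

module ToModel {n m : ℕ} (φ : GP2 n m) (g : OneTp n m → BVec n m)
  (g-star : (π : OneTp n m) → InOneTps φ π → Star (InB φ π) (g π))
  (g-matching : (π₁ : OneTp n m) (η : TwoTp⁺ m) (π₂ : OneTp n m) →
                InOneTps φ π₁ → InOneTps φ π₂ → g π₁ η π₂ ≡ g π₂ (dual⁺ η) π₁) where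

  record Element : Set where
    constructor element
    field
      type      : OneTp n m
      demand    : BVec n m
      type-ok   : InOneTps φ type
      demand-ok : InB φ type demand

  open Element

  elementsFrom : (π : OneTp n m) → InOneTps φ π → (fs : List (BVec n m)) → All (InB φ π) fs → List Element
  elementsFrom π π-ok []       []            = []
  elementsFrom π π-ok (f ∷ fs) (f-ok ∷ fs-ok) = element π f π-ok f-ok ∷ elementsFrom π π-ok fs fs-ok

  ∑-elementsFrom : (π : OneTp n m) (π-ok : InOneTps φ π) (fs : List (BVec n m)) (fs-ok : All (InB φ π) fs)
    (F : OneTp n m → BVec n m → ℕ) → ∑ (elementsFrom π π-ok fs fs-ok) (λ e → F (type e) (demand e)) ≡ ∑ fs (F π)
  ∑-elementsFrom π π-ok []       []            F = refl
  ∑-elementsFrom π π-ok (f ∷ fs) (f-ok ∷ fs-ok) F = cong (F π f +_) (∑-elementsFrom π π-ok fs fs-ok F)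

  elementsOf : (π : OneTp n m) → Dec (InOneTps φ π) → List Element
  elementsOf π (yes π-ok) = elementsFrom π π-ok (proj₁ (g-star π π-ok)) (proj₁ (proj₂ (g-star π π-ok)))
  elementsOf π (no _)     = []

  elements : List Element
  elements = concatMap (λ π → elementsOf π (inOneTps? φ π)) (allOneTps n m)

  weight : OneTp n m → TwoTp m → OneTp n m → Element → ℕ
  weight π η π′ e = 𝟙 (type e ≟₁ π) * ext (demand e) η π′

  weights : OneTp n m → TwoTp m → OneTp n m → List ℕ
  weights π η π′ = map (weight π η π′) elements

  slots : OneTp n m → TwoTp m → OneTp n m → ℕ
  slots π η π′ = sumℕ (weights π η π′)

  slots≡g : (π : OneTp n m) → InOneTps φ π → (η : TwoTp m) (π′ : OneTp n m) → slots π η π′ ≡ ext (g π) η π′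
  slots≡g π π-ok η π′ = begin
    ∑ elements (weight π η π′)
      ≡⟨ ∑-concatMap (allOneTps n m) _ (weight π η π′) ⟩
    ∑ (allOneTps n m) (λ ρ → ∑ (elementsOf ρ (inOneTps? φ ρ)) (weight π η π′))
      ≡⟨ ∑-pick (enumerates-allOneTps n m) _ π (λ ρ ρ≢π → other-type ρ ρ≢π (inOneTps? φ ρ)) ⟩
    ∑ (elementsOf π (inOneTps? φ π)) (weight π η π′)
      ≡⟨ own-type (inOneTps? φ π) ⟩
    ext (g π) η π′ ∎
    where
    open ≡-Reasoning
    other-type : (ρ : OneTp n m) → ρ ≢ π → (d : Dec (InOneTps φ ρ)) → ∑ (elementsOf ρ d) (weight π η π′) ≡ 0
    other-type ρ ρ≢π (yes ρ-ok) = let (fs , fs-ok , _) = g-star ρ ρ-ok in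
      trans (∑-elementsFrom ρ ρ-ok fs fs-ok (λ ρ′ f → 𝟙 (ρ′ ≟₁ π) * ext f η π′))
            (∑-zero fs (λ f → cong (_* ext f η π′) (𝟙-no (ρ ≟₁ π) ρ≢π)))
    other-type ρ ρ≢π (no _) = refl
    own-type : (d : Dec (InOneTps φ π)) → ∑ (elementsOf π d) (weight π η π′) ≡ ext (g π) η π′
    own-type (yes π-ok′) = let (fs , fs-ok , g≈∑fs) = g-star π π-ok′ in begin
      ∑ (elementsFrom π π-ok′ fs fs-ok) (weight π η π′)
        ≡⟨ ∑-elementsFrom π π-ok′ fs fs-ok (λ ρ′ f → 𝟙 (ρ′ ≟₁ π) * ext f η π′) ⟩
      ∑ fs (λ f → 𝟙 (π ≟₁ π) * ext f η π′)
        ≡⟨ ∑-cong fs (λ f → 𝟙-*-yes (π ≟₁ π) refl _) ⟩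
      ∑ fs (λ f → ext f η π′)
        ≡⟨ sym (ext-sumB fs η π′) ⟩
      ext (sumB fs) η π′
        ≡⟨ sym (ext-cong g≈∑fs η π′) ⟩
      ext (g π) η π′ ∎
    own-type (no ¬π-ok) = ⊥-elim (¬π-ok π-ok)

  slots-dual : {π π′ : OneTp n m} → InOneTps φ π → InOneTps φ π′ → (η : TwoTp m) →
    slots π η π′ ≡ slots π′ (dual η) π
  slots-dual π-ok π′-ok η = trans (slots≡g _ π-ok η _)
    (trans (ext-dual (λ η⁺ → g-matching _ η⁺ _ π-ok π′-ok) η) (sym (slots≡g _ π′-ok (dual η) _)))

  -- Every slots π η π′ is below slotBound, so slots can be numbered in Fin slotBound and coded by one-hot vectors.
  slotBound : ℕ
  slotBound = ∑ elements (λ e → ∑ (allTwoTps m) (λ η → ∑ (allOneTps n m) (ext (demand e) η)))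

  slots≤slotBound : (π : OneTp n m) (η : TwoTp m) (π′ : OneTp n m) → slots π η π′ ≤ slotBound
  slots≤slotBound π η π′ = ∑-mono-≤ elements λ e → begin
    weight π η π′ e                                        ≤⟨ 𝟙-*-≤ (type e ≟₁ π) _ ⟩
    ext (demand e) η π′                                    ≤⟨ term≤∑ (enumerates-allOneTps n m) _≟₁_ _ π′ ⟩
    ∑ (allOneTps n m) (ext (demand e) η)                   ≤⟨ term≤∑ (enumerates-allTwoTps m) _≟₂_ _ η ⟩
    ∑ (allTwoTps m) (λ η → ∑ (allOneTps n m) (ext (demand e) η)) ∎
    where open ≤-Reasoning

  record Owns (π : OneTp n m) (η : TwoTp m) (π′ : OneTp n m) (p : Fin slotBound) (j : Fin (length elements)) : Set where
    constructor owns
    field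
      in-range : toℕ p < slots π η π′
      owner    : blockOf (weights π η π′) (toℕ p) ≡ toℕ j

  owns? : (π : OneTp n m) (η : TwoTp m) (π′ : OneTp n m) (p : Fin slotBound) (j : Fin (length elements)) →
    Dec (Owns π η π′ p j)
  owns? π η π′ p j = map′ (λ (p<slots , owner) → owns p<slots owner) (λ (owns p<slots owner) → p<slots , owner)
    ((toℕ p <? slots π η π′) ×-dec (blockOf (weights π η π′) (toℕ p) ≟ toℕ j))

  owner-exists : (π : OneTp n m) (η : TwoTp m) (π′ : OneTp n m) (p : Fin slotBound) →
    toℕ p < slots π η π′ → Σ (Fin (length elements)) (Owns π η π′ p)
  owner-exists π η π′ p p<slots = Data.Fin.fromℕ< j<length , owns p<slots (sym (Fin.toℕ-fromℕ< j<length))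
    where
    ws = weights π η π′
    j<length : blockOf ws (toℕ p) < length elements
    j<length = subst (blockOf ws (toℕ p) <_) (List.length-map (weight π η π′) elements)
                     (nth-pos⇒< ws _ (nth-blockOf-pos ws p<slots))

  owner-unique : {π : OneTp n m} {η : TwoTp m} {π′ : OneTp n m} {p : Fin slotBound} {j j′ : Fin (length elements)} →
    Owns π η π′ p j → Owns π η π′ p j′ → j ≡ j′
  owner-unique (owns _ owner) (owns _ owner′) = Fin.toℕ-injective (trans (sym owner) owner′)

  owner-weight : {π : OneTp n m} {η : TwoTp m} {π′ : OneTp n m} {p : Fin slotBound} {j : Fin (length elements)} →
    Owns π η π′ p j → type (Data.List.lookup elements j) ≡ π × 0 < ext (demand (Data.List.lookup elements j)) η π′
  owner-weight {π} {η} {π′} {p} {j} (owns p<slots owner) = 𝟙-*-positive (type e ≟₁ π) _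
    (subst (0 <_) (trans (cong (nth ws) owner) (nth-map (weight π η π′) elements j)) (nth-blockOf-pos ws p<slots))
    where
    ws = weights π η π′
    e = Data.List.lookup elements j

  Label : Set
  Label = TwoTp m × Vec Bool slotBound

  _⊕_ : Label → Label → Label
  ((f , b) , u) ⊕ ((f′ , b′) , u′) = (f ⊕ᵥ f′ , b ⊕ᵥ b′) , u ⊕ᵥ u′

  ⊕-cancelʳ : (l c : Label) → (l ⊕ c) ⊕ c ≡ l
  ⊕-cancelʳ ((f , b) , u) ((f′ , b′) , u′) =
    cong₂ _,_ (cong₂ _,_ (⊕ᵥ-cancelʳ f f′) (⊕ᵥ-cancelʳ b b′)) (⊕ᵥ-cancelʳ u u′)

  ⊕-cancelˡ : (l c : Label) → l ⊕ (l ⊕ c) ≡ c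
  ⊕-cancelˡ ((f , b) , u) ((f′ , b′) , u′) =
    cong₂ _,_ (cong₂ _,_ (⊕ᵥ-cancelˡ f f′) (⊕ᵥ-cancelˡ b b′)) (⊕ᵥ-cancelˡ u u′)

  ⊕-injective : (l : Label) {c c′ : Label} → l ⊕ c ≡ l ⊕ c′ → c ≡ c′
  ⊕-injective l {c} {c′} eq = trans (sym (⊕-cancelˡ l c)) (trans (cong (l ⊕_) eq) (⊕-cancelˡ l c′))

  code : TwoTp m → Fin slotBound → Label
  code η p = η , oneHot p

  _≟ₗ_ : DecidableEquality Label
  _≟ₗ_ = Product.≡-dec _≟₂_ _≟ᵥ_

  labels : List Label
  labels = concatMap (λ η → map (η ,_) (allBoolVecs slotBound)) (allTwoTps m)

  Copy : Set
  Copy = Fin (length elements) × Bool × Label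

  copies : List Copy
  copies = concatMap (λ j → map (j ,_) (concatMap (λ s → map (s ,_) labels) (true ∷ false ∷ [])))
                     (allFin (length elements))

  enumerates-copies : Enumerates copies
  enumerates-copies = enumerates-product (enumerates-allFin (length elements))
    (enumerates-product enumerates-bools (enumerates-product (enumerates-allTwoTps m) (enumerates-allBoolVecs slotBound)))

  _≟c_ : DecidableEquality Copy
  _≟c_ = Product.≡-dec Fin._≟_ (Product.≡-dec Bool._≟_ _≟ₗ_)

  index : Copy → Fin (length elements)
  index = proj₁

  side : Copy → Bool
  side = proj₁ ∘ proj₂

  label : Copy → Label
  label = proj₂ ∘ proj₂

  elementOf : Copy → Element
  elementOf = Data.List.lookup elements ∘ index

  typeOf : Copy → OneTp n m
  typeOf = type ∘ elementOf

  demandOf : Copy → BVec n m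
  demandOf = demand ∘ elementOf

  -- Copies on opposite sides are joined through slot p of kind η when p is owned by their elements on
  -- both sides and their labels differ by the code of (η, p), read from the false side; the labels
  -- thus determine η and p, so two copies are joined through at most one slot.
  record Linked (x y : Copy) (η : TwoTp m) (p : Fin slotBound) : Set where
    constructor linked
    field
      sides  : side y ≡ not (side x)
      owns-x : Owns (typeOf x) η (typeOf y) p (index x)
      owns-y : Owns (typeOf y) (dual η) (typeOf x) p (index y)
      shift  : label y ≡ label x ⊕ code (orient (side x) η) p

  linked? : (x y : Copy) (η : TwoTp m) (p : Fin slotBound) → Dec (Linked x y η p)
  linked? x y η p = map′ (λ (s , ox , oy , l) → linked s ox oy l) (λ (linked s ox oy l) → s , ox , oy , l)
    ((side y Bool.≟ not (side x))
      ×-dec (owns? (typeOf x) η (typeOf y) p (index x)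
      ×-dec (owns? (typeOf y) (dual η) (typeOf x) p (index y)
      ×-dec (label y ≟ₗ (label x ⊕ code (orient (side x) η) p)))))

  candidate : Copy → Copy → TwoTp m
  candidate x y = orient (side x) (proj₁ (label x ⊕ label y))

  linked⇒candidate : {x y : Copy} {η : TwoTp m} {p : Fin slotBound} → Linked x y η p → η ≡ candidate x y
  linked⇒candidate {x} {y} {η} {p} (linked _ _ _ label-y) = sym (begin
    orient (side x) (proj₁ (label x ⊕ label y))
      ≡⟨ cong (orient (side x) ∘ proj₁) (trans (cong (label x ⊕_) label-y) (⊕-cancelˡ (label x) _)) ⟩
    orient (side x) (orient (side x) η)
      ≡⟨ orient-involutive (side x) η ⟩
    η ∎)
    where open ≡-Reasoning

  linked-unique : {x y : Copy} {η : TwoTp m} {p q : Fin slotBound} → Linked x y η p → Linked x y η q → p ≡ q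
  linked-unique {x} (linked _ _ _ label-y) (linked _ _ _ label-y′) =
    oneHot-injective (cong proj₂ (⊕-injective (label x) (trans (sym label-y) label-y′)))

  linked-sym : {x y : Copy} {η : TwoTp m} {p : Fin slotBound} → Linked x y η p → Linked y x (dual η) p
  linked-sym {x} {y} {η} {p} (linked side-y owns-x owns-y label-y) = linked side-x owns-y owns-x label-x
    where
    side-x : side x ≡ not (side y)
    side-x = trans (sym (Bool.not-involutive (side x))) (cong not (sym side-y))
    label-x : label x ≡ label y ⊕ code (orient (side y) (dual η)) p
    label-x = sym (begin
      label y ⊕ code (orient (side y) (dual η)) p         ≡⟨ cong (λ s → label y ⊕ code (orient s (dual η)) p) side-y ⟩
      label y ⊕ code (orient (not (side x)) (dual η)) p   ≡⟨ cong (λ o → label y ⊕ code o p) (orient-not-dual (side x) η) ⟩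
      label y ⊕ code (orient (side x) η) p                ≡⟨ cong (_⊕ code (orient (side x) η) p) label-y ⟩
      (label x ⊕ code (orient (side x) η) p) ⊕ code (orient (side x) η) p ≡⟨ ⊕-cancelʳ (label x) _ ⟩
      label x                                             ∎)
      where open ≡-Reasoning

  linked-irreflexive : {x : Copy} {η : TwoTp m} {p : Fin slotBound} → ¬ Linked x x η p
  linked-irreflexive (linked side-x _ _ _) = Bool.not-¬ refl side-x

  linked-compatible : {x y : Copy} {η : TwoTp m} {p : Fin slotBound} → Linked x y η p →
    Compatible φ (typeOf x) η (typeOf y)
  linked-compatible {x} {y} {η} (linked _ owns-x _ _) = decidable-stable (compatible? φ (typeOf x) η (typeOf y)) λ ¬compat →
    let (η-aud , demand>0) = ext-positive (demandOf x) η (typeOf y) (proj₂ (owner-weight owns-x))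
    in <-irrefl (sym (proj₁ (proj₂ (demand-ok (elementOf x))) (η , η-aud) (typeOf y) ¬compat)) demand>0

  HasEdge : Copy → Copy → Set
  HasEdge x y = Σ (Fin slotBound) (Linked x y (candidate x y))

  edgeType : Copy → Copy → TwoTp m
  edgeType x y with Fin.any? (linked? x y (candidate x y))
  ... | yes _ = candidate x y
  ... | no  _ = silent

  linked⇒HasEdge : {x y : Copy} {η : TwoTp m} {p : Fin slotBound} → Linked x y η p → HasEdge x y
  linked⇒HasEdge {x} {y} {p = p} x~y = p , subst (λ η → Linked x y η p) (linked⇒candidate x~y) x~y

  edgeType-linked : {x y : Copy} {η : TwoTp m} {p : Fin slotBound} → Linked x y η p → edgeType x y ≡ η
  edgeType-linked {x} {y} x~y with Fin.any? (linked? x y (candidate x y))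
  ... | yes _       = sym (linked⇒candidate x~y)
  ... | no  ¬linked = ⊥-elim (¬linked (linked⇒HasEdge x~y))

  edgeType-audible : (x y : Copy) → T (audible (edgeType x y)) → Σ (Fin slotBound) (Linked x y (edgeType x y))
  edgeType-audible x y aud with Fin.any? (linked? x y (candidate x y))
  ... | yes x~y = x~y
  ... | no  _   = ⊥-elim (silent-inaudible {m} aud)

  edgeType-sym : (x y : Copy) → edgeType y x ≡ dual (edgeType x y)
  edgeType-sym x y with Fin.any? (linked? x y (candidate x y)) | Fin.any? (linked? y x (candidate y x))
  ... | yes (_ , x~y) | yes _         = sym (linked⇒candidate (linked-sym x~y))
  ... | yes (_ , x~y) | no  ¬y~x      = ⊥-elim (¬y~x (linked⇒HasEdge (linked-sym x~y)))
  ... | no  ¬x~y      | yes (_ , y~x) = ⊥-elim (¬x~y (linked⇒HasEdge (linked-sym y~x)))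
  ... | no  _         | no  _         = refl

  edgeType-self : (x : Copy) → edgeType x x ≡ silent
  edgeType-self x with Fin.any? (linked? x x (candidate x x))
  ... | yes (_ , x~x) = ⊥-elim (linked-irreflexive x~x)
  ... | no  _         = refl

  edgeType-slots : (x y : Copy) (η : TwoTp m) → T (audible η) →
    𝟙 (edgeType x y ≟₂ η) ≡ ∑ (allFin slotBound) (𝟙 ∘ linked? x y η)
  edgeType-slots x y η aud = sym (∑-𝟙-unique (enumerates-allFin slotBound) (linked? x y η) (edgeType x y ≟₂ η)
    (λ _ → edgeType-linked) unique-slot)
    where
    unique-slot : edgeType x y ≡ η → Σ (Fin slotBound) λ p → Linked x y η p × (∀ q → Linked x y η q → q ≡ p)
    unique-slot refl = let (p , x~y) = edgeType-audible x y aud in p , x~y , λ q x~y′ → linked-unique x~y′ x~y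

  slot-partner : (x : Copy) (η : TwoTp m) {π′ : OneTp n m} → InOneTps φ π′ → (p : Fin slotBound) →
    ∑ copies (λ y → 𝟙 (typeOf y ≟₁ π′ ×-dec linked? x y η p)) ≡ 𝟙 (owns? (typeOf x) η π′ p (index x))
  slot-partner x η {π′} π′-ok p = ∑-𝟙-unique enumerates-copies _ (owns? (typeOf x) η π′ p (index x))
    (λ y (y-π′ , x~y) → subst (λ π → Owns (typeOf x) η π p (index x)) y-π′ (Linked.owns-x x~y))
    partner
    where
    partner : Owns (typeOf x) η π′ p (index x) →
      Σ Copy λ y → (typeOf y ≡ π′ × Linked x y η p) × (∀ y′ → typeOf y′ ≡ π′ × Linked x y′ η p → y′ ≡ y)
    partner owns-x@(owns p<slots _) = y , (y-π′ , x~y) , only-y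
      where
      p<slots′ : toℕ p < slots π′ (dual η) (typeOf x)
      p<slots′ = subst (toℕ p <_) (slots-dual (type-ok (elementOf x)) π′-ok η) p<slots
      j = proj₁ (owner-exists π′ (dual η) (typeOf x) p p<slots′)
      owns-j = proj₂ (owner-exists π′ (dual η) (typeOf x) p p<slots′)
      y : Copy
      y = j , not (side x) , label x ⊕ code (orient (side x) η) p
      y-π′ : typeOf y ≡ π′
      y-π′ = proj₁ (owner-weight owns-j)
      x~y : Linked x y η p
      x~y = linked refl (subst (λ π → Owns (typeOf x) η π p (index x)) (sym y-π′) owns-x)
                        (subst (λ π → Owns π (dual η) (typeOf x) p j) (sym y-π′) owns-j) refl
      only-y : ∀ y′ → typeOf y′ ≡ π′ × Linked x y′ η p → y′ ≡ y
      only-y (j′ , s′ , l′) (y′-π′ , linked s′≡ _ owns-j′ l′≡) = cong₂ _,_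
        (owner-unique (subst (λ π → Owns π (dual η) (typeOf x) p j′) y′-π′ owns-j′) owns-j)
        (cong₂ _,_ s′≡ l′≡)

  𝟙-owns : (π : OneTp n m) (η : TwoTp m) (π′ : OneTp n m) (p : Fin slotBound) (j : Fin (length elements)) →
    𝟙 (owns? π η π′ p j) ≡ 𝟙 (toℕ p <? slots π η π′) * 𝟙 (blockOf (weights π η π′) (toℕ p) ≟ toℕ j)
  𝟙-owns π η π′ p j = trans
    (𝟙-cong (owns? π η π′ p j) (toℕ p <? slots π η π′ ×-dec blockOf (weights π η π′) (toℕ p) ≟ toℕ j)
            (λ (owns p<slots owner) → p<slots , owner) (λ (p<slots , owner) → owns p<slots owner))
    (𝟙-×-dec (toℕ p <? slots π η π′) (blockOf (weights π η π′) (toℕ p) ≟ toℕ j))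

  edgeType-typeOf-slots : (x y : Copy) {η : TwoTp m} → T (audible η) → (π′ : OneTp n m) →
    𝟙 (edgeType x y ≟₂ η) * 𝟙 (typeOf y ≟₁ π′)
      ≡ ∑ (allFin slotBound) (λ p → 𝟙 (typeOf y ≟₁ π′ ×-dec linked? x y η p))
  edgeType-typeOf-slots x y {η} aud π′ = begin
    𝟙 (edgeType x y ≟₂ η) * 𝟙 (typeOf y ≟₁ π′)
      ≡⟨ cong (_* 𝟙 (typeOf y ≟₁ π′)) (edgeType-slots x y η aud) ⟩
    ∑ (allFin slotBound) (𝟙 ∘ linked? x y η) * 𝟙 (typeOf y ≟₁ π′)
      ≡⟨ *-comm (∑ (allFin slotBound) (𝟙 ∘ linked? x y η)) (𝟙 (typeOf y ≟₁ π′)) ⟩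
    𝟙 (typeOf y ≟₁ π′) * ∑ (allFin slotBound) (𝟙 ∘ linked? x y η)
      ≡⟨ sym (∑-*ˡ (allFin slotBound) (𝟙 (typeOf y ≟₁ π′)) (𝟙 ∘ linked? x y η)) ⟩
    ∑ (allFin slotBound) (λ p → 𝟙 (typeOf y ≟₁ π′) * 𝟙 (linked? x y η p))
      ≡⟨ ∑-cong (allFin slotBound) (λ p → sym (𝟙-×-dec (typeOf y ≟₁ π′) (linked? x y η p))) ⟩
    ∑ (allFin slotBound) (λ p → 𝟙 (typeOf y ≟₁ π′ ×-dec linked? x y η p)) ∎
    where open ≡-Reasoning

  partners-outside : (x : Copy) {η : TwoTp m} → T (audible η) → (π′ : OneTp n m) → ¬ InOneTps φ π′ →
    ∑ copies (λ y → 𝟙 (edgeType x y ≟₂ η) * 𝟙 (typeOf y ≟₁ π′)) ≡ ext (demandOf x) η π′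
  partners-outside x {η} aud π′ ¬π′-ok = trans
    (∑-zero copies (λ y → trans (cong (𝟙 (edgeType x y ≟₂ η) *_) (𝟙-no (typeOf y ≟₁ π′) (¬π′-ok ∘ retype y)))
                                (*-zeroʳ (𝟙 (edgeType x y ≟₂ η)))))
    (sym (trans (ext-audible (demandOf x) η π′ aud) (proj₁ (demand-ok (elementOf x)) (η , aud) π′ ¬π′-ok)))
    where
    retype : (y : Copy) → typeOf y ≡ π′ → InOneTps φ π′
    retype y y-π′ = subst (InOneTps φ) y-π′ (type-ok (elementOf y))

  partners-inside : (x : Copy) {η : TwoTp m} → T (audible η) → (π′ : OneTp n m) → InOneTps φ π′ →
    ∑ copies (λ y → 𝟙 (edgeType x y ≟₂ η) * 𝟙 (typeOf y ≟₁ π′)) ≡ ext (demandOf x) η π′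
  partners-inside x {η} aud π′ π′-ok = begin
    ∑ copies (λ y → 𝟙 (edgeType x y ≟₂ η) * 𝟙 (typeOf y ≟₁ π′))
      ≡⟨ ∑-cong copies (λ y → edgeType-typeOf-slots x y aud π′) ⟩
    ∑ copies (λ y → ∑ (allFin slotBound) (λ p → 𝟙 (typeOf y ≟₁ π′ ×-dec linked? x y η p)))
      ≡⟨ ∑-comm copies (allFin slotBound) (λ y p → 𝟙 (typeOf y ≟₁ π′ ×-dec linked? x y η p)) ⟩
    ∑ (allFin slotBound) (λ p → ∑ copies (λ y → 𝟙 (typeOf y ≟₁ π′ ×-dec linked? x y η p)))
      ≡⟨ ∑-cong (allFin slotBound) (λ p → trans (slot-partner x η π′-ok p) (𝟙-owns (typeOf x) η π′ p (index x))) ⟩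
    ∑ (allFin slotBound) (F ∘ toℕ)
      ≡⟨ ∑-allFin-toℕ slotBound F ⟩
    ∑< slotBound F
      ≡⟨ ∑<-restrict (slots≤slotBound (typeOf x) η π′) (λ q → 𝟙 (blockOf ws q ≟ toℕ (index x))) ⟩
    ∑< (slots (typeOf x) η π′) (λ q → 𝟙 (blockOf ws q ≟ toℕ (index x)))
      ≡⟨ blockOf-size ws (toℕ (index x)) ⟩
    nth ws (toℕ (index x))
      ≡⟨ nth-map (weight (typeOf x) η π′) elements (index x) ⟩
    𝟙 (typeOf x ≟₁ typeOf x) * ext (demandOf x) η π′
      ≡⟨ 𝟙-*-yes (typeOf x ≟₁ typeOf x) refl (ext (demandOf x) η π′) ⟩
    ext (demandOf x) η π′ ∎
    where
    open ≡-Reasoning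
    ws = weights (typeOf x) η π′
    F : ℕ → ℕ
    F q = 𝟙 (q <? slots (typeOf x) η π′) * 𝟙 (blockOf ws q ≟ toℕ (index x))

  partners : (x : Copy) {η : TwoTp m} → T (audible η) → (π′ : OneTp n m) →
    ∑ copies (λ y → 𝟙 (edgeType x y ≟₂ η) * 𝟙 (typeOf y ≟₁ π′)) ≡ ext (demandOf x) η π′
  partners x aud π′ = by-cases (inOneTps? φ π′)
    where
    by-cases : Dec (InOneTps φ π′) → _
    by-cases (yes π′-ok) = partners-inside x aud π′ π′-ok
    by-cases (no ¬π′-ok) = partners-outside x aud π′ ¬π′-ok

  copyAt : Fin (length copies) → Copy
  copyAt = Data.List.lookup copies

  model : Structure n m (length copies)
  model = record
    { U = λ i a → lookup (proj₁ (typeOf (copyAt a))) i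
    ; R = λ i a b → if ⌊ a Fin.≟ b ⌋ then lookup (proj₂ (typeOf (copyAt a))) i
                                     else lookup (proj₁ (edgeType (copyAt a) (copyAt b))) i
    }

  realizes-typeOf : (a : Fin (length copies)) → Realizes₁ model a (typeOf (copyAt a))
  realizes-typeOf a = (λ _ → refl) , (λ i → if-true (⌊⌋-yes (a Fin.≟ a) refl))

  realizes-edgeType : {a b : Fin (length copies)} → a ≢ b → Realizes₂ model a b (edgeType (copyAt a) (copyAt b))
  realizes-edgeType {a} {b} a≢b =
      (λ i → if-false (⌊⌋-no (a Fin.≟ b) a≢b))
    , (λ i → trans (if-false (⌊⌋-no (b Fin.≟ a) (a≢b ∘ sym)))
                   (cong (λ η → lookup (proj₁ η) i) (edgeType-sym (copyAt a) (copyAt b))))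

  neighbour-model : (a : Fin (length copies)) {η : TwoTp m} → T (audible η) → (π′ : OneTp n m) (b : Fin (length copies)) →
    𝟙 (neighbour? model a η π′ b) ≡ 𝟙 (edgeType (copyAt a) (copyAt b) ≟₂ η) * 𝟙 (typeOf (copyAt b) ≟₁ π′)
  neighbour-model a {η} aud π′ b = trans
    (𝟙-cong (neighbour? model a η π′ b) (edgeType (copyAt a) (copyAt b) ≟₂ η ×-dec typeOf (copyAt b) ≟₁ π′)
      (λ (a≢b , ab-η , b-π′) → trans (sym (twoType-unique model (realizes-edgeType a≢b))) ab-η
                             , trans (sym (oneType-unique model (realizes-typeOf b))) b-π′)
      (λ (e-η , b-π′) → let a≢b = distinct e-η in
          a≢b , trans (twoType-unique model (realizes-edgeType a≢b)) e-η , trans (oneType-unique model (realizes-typeOf b)) b-π′))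
    (𝟙-×-dec (edgeType (copyAt a) (copyAt b) ≟₂ η) (typeOf (copyAt b) ≟₁ π′))
    where
    distinct : edgeType (copyAt a) (copyAt b) ≡ η → a ≢ b
    distinct e-η a≡b = silent-inaudible {m} (subst (T ∘ audible) η≡silent aud)
      where
      η≡silent : η ≡ silent
      η≡silent = trans (sym e-η) (trans (cong (edgeType (copyAt a) ∘ copyAt) (sym a≡b)) (edgeType-self (copyAt a)))

  behaviour-model : (a : Fin (length copies)) → behaviourB model a ≈B demandOf (copyAt a)
  behaviour-model a (η , aud) π′ = begin
    ∑ (allFin (length copies)) (𝟙 ∘ neighbour? model a η π′)
      ≡⟨ ∑-cong (allFin (length copies)) (neighbour-model a aud π′) ⟩
    ∑ (allFin (length copies)) (F ∘ copyAt)
      ≡⟨ ∑-allFin-lookup copies F ⟩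
    ∑ copies F
      ≡⟨ partners (copyAt a) aud π′ ⟩
    ext (demandOf (copyAt a)) η π′
      ≡⟨ ext-audible (demandOf (copyAt a)) η π′ aud ⟩
    demandOf (copyAt a) (η , aud) π′ ∎
    where
    open ≡-Reasoning
    F : Copy → ℕ
    F y = 𝟙 (edgeType (copyAt a) y ≟₂ η) * 𝟙 (typeOf y ≟₁ π′)

  model⊨φ : model ⊨ φ
  model⊨φ = types-ok , edges-compatible , counting
    where
    types-ok : (a : Fin (length copies)) → eval model (λ _ → a) (γ φ) ≡ true
    types-ok a = type-ok (elementOf (copyAt a)) _ model a (realizes-typeOf a)
    edges-compatible : (i : Fin m) (a b : Fin (length copies)) → R model i a b ≡ true → a ≢ b →
      eval model (env₂ a b) (α φ i) ≡ true
    edges-compatible i a b Rᵢab a≢b =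
      let aud = audible-lookup (edgeType (copyAt a) (copyAt b)) i (trans (sym (proj₁ (realizes-edgeType a≢b) i)) Rᵢab)
          (_ , a~b) = edgeType-audible (copyAt a) (copyAt b) aud
      in proj₁ (linked-compatible a~b) _ model a b (realizes-typeOf a) (realizes-edgeType a≢b) (realizes-typeOf b) i Rᵢab a≢b
    counting : (i : Fin n) (a : Fin (length copies)) → U model i a ≡ true →
      holdsCmp (cmp φ i) (sumℤ (map (λ t → lam φ i t ℤ.* (ℤ.+ countR model t a)) (allFin m))) (δ φ i)
    counting i a Uᵢa = subst (λ s → holdsCmp (cmp φ i) s (δ φ i))
      (trans (linSum-cong φ i (λ η π → sym (behaviour-model a η π))) (linSum-behaviourB model φ i a))
      (proj₂ (proj₂ (demand-ok (elementOf (copyAt a)))) i Uᵢa)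

  finitelySatisfiable : (π₀ : OneTp n m) → InOneTps φ π₀ → ¬ (g π₀ ≈B zeroB) → FinitelySatisfiable φ
  finitelySatisfiable π₀ π₀-ok g≉0 =
    length copies ∸ 1 , subst (λ K → Σ (Structure n m K) (_⊨ φ)) (length≡suc copies copies≢[]) (model , model⊨φ)
    where
    elements≢[] : ¬ elements ≡ []
    elements≢[] elements≡[] = g≉0 λ η π′ → begin
      g π₀ η π′                ≡⟨ sym (ext-audible (g π₀) (proj₁ η) π′ (proj₂ η)) ⟩
      ext (g π₀) (proj₁ η) π′  ≡⟨ sym (slots≡g π₀ π₀-ok (proj₁ η) π′) ⟩
      slots π₀ (proj₁ η) π′    ≡⟨ cong (λ es → ∑ es (weight π₀ (proj₁ η) π′)) elements≡[] ⟩
      0                        ∎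
      where open ≡-Reasoning
    copies≢[] : ¬ copies ≡ []
    copies≢[] = enumerates-nonempty enumerates-copies _≟c_
      (firstIndex elements elements≢[] , true , silent , Data.Vec.replicate slotBound false)

lemma16 : {n m : ℕ} (φ : GP2 n m) →
    ((π : OneTp n m) → InOneTps φ π → ¬ InB φ π zeroB) →
    FinitelySatisfiable φ ⇔
      (Σ (OneTp n m → BVec n m) λ g →
        ((π : OneTp n m) → InOneTps φ π → Star (InB φ π) (g π))
        × ((π₁ : OneTp n m) (η : TwoTp⁺ m) (π₂ : OneTp n m) →
             InOneTps φ π₁ → InOneTps φ π₂ →
             g π₁ η π₂ ≡ g π₂ (dual⁺ η) π₁)
        × (Σ (OneTp n m) λ π → InOneTps φ π × ¬ (g π ≈B zeroB)))
lemma16 φ 0∉B = mk⇔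
  (λ (_ , A , A⊨φ) → let open FromModel φ A A⊨φ in
      g , (λ π _ → g-star π) , (λ π₁ η π₂ _ _ → g-matching π₁ η π₂)
    , oneType A zero , oneType-inOneTps zero , g-nontrivial 0∉B)
  (λ (g , g-star , g-matching , π₀ , π₀-ok , g≉0) → ToModel.finitelySatisfiable φ g g-star g-matching π₀ π₀-ok g≉0)
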